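{- Let $m,r$ be relatively prime positive integers, let $s=\gcd(r-1,m)$, $t=m/s$, and let $n$ be the smallest positive integer with $r^n\equiv 1\pmod m$. Suppose $n=2$, $m=2^{\alpha}m'\le 12$, $s=2s'$, $\gcd(s,t)=2$ and $r\equiv -1\pmod{2^{\alpha}}$, where $\alpha\ge 2$ is an integer and $m',s'$ are odd integers. Then $G_{m,r}$ can be embedded in (the multiplicative group of) a division ring if and only if $G_{m,r}$ is isomorphic to one of $Q_8$, $\mathrm{Dic}_{16}$, $\mathrm{Dic}_{24}$.
   Context: $G_{m,r}$ is the group generated by $a,b$ with relations $a^m=1$, $b^n=a^t$, $bab^{ -1}=a^r$ (of order $mn$). $Q_8$ is the quaternion group of order 8, and $\mathrm{Dic}_{4k}=\langle a,b\mid a^{2k}=1,b^2=a^k,bab^{ -1}=a^{ -1}\rangle$ denotes the dicyclic group of order $4k$. -}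

module Defs where

open import Level using (0ℓ)
open import Data.Nat using (ℕ; zero; suc; _+_; _*_; _^_; _≤_; _<_; _≤ᵇ_; NonZero)
open import Data.Nat.DivMod using (_mod_; _%_)
open import Data.Nat.Properties using (m*n≢0)
open import Data.Fin using (Fin; toℕ)
open import Data.Bool using (if_then_else_)
open import Data.Product using (_×_; _,_; Σ; ∃)
open import Relation.Binary.PropositionalEquality using (_≡_)
open import Relation.Nullary using (¬_)
open import Algebra.Bundles using (Ring)

record MGroup : Set₁ where
  field
    Carrier : Set
    _∙_     : Carrier → Carrier → Carrier
    ε       : Carrier

-- The metacyclic group  ⟨ a , b | a^m = 1 , b^n = a^t , b a b⁻¹ = a^r ⟩
-- realised on its normal forms  a^i b^j  (0 ≤ i < m, 0 ≤ j < n).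
-- Multiplication:  a^i b^j · a^k b^l = a^(i + r^j k) b^(j+l),
-- and if j + l ≥ n we use b^n = a^t to reduce, giving
-- a^(i + r^j k + t) b^(j+l-n).  (Exponents of a are taken mod m,
-- exponents of b mod n.)

Meta : (m n r t : ℕ) → .{{_ : NonZero m}} → .{{_ : NonZero n}} → MGroup
Meta m n r t = record
  { Carrier = Fin m × Fin n
  ; _∙_     = mul
  ; ε       = (0 mod m , 0 mod n)
  }
  where
  mul : Fin m × Fin n → Fin m × Fin n → Fin m × Fin n
  mul (i , j) (k , l) =
    ( (toℕ i + r ^ toℕ j * toℕ k
         + (if n ≤ᵇ toℕ j + toℕ l then t else 0)) mod m
    , (toℕ j + toℕ l) mod n )

G : (m r n t : ℕ) → .{{_ : NonZero m}} → .{{_ : NonZero n}} → MGroup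
G m r n t = Meta m n r t

-- Dicyclic group of order 4k:
--   ⟨ a , b | a^(2k) = 1 , b^2 = a^k , b a b⁻¹ = a⁻¹ = a^(2k-1) ⟩.
Dic : (k : ℕ) → .{{_ : NonZero k}} → MGroup
Dic (suc k) = Meta (2 * suc k) 2 (2 * suc k Data.Nat.∸ 1) (suc k)
  where instance _ = m*n≢0 2 (suc k)

Q8 : MGroup
Q8 = Dic 2

Dic16 : MGroup
Dic16 = Dic 4

Dic24 : MGroup
Dic24 = Dic 6

_≅_ : MGroup → MGroup → Set
H ≅ K =
  Σ (H.Carrier → K.Carrier) λ f →
  Σ (K.Carrier → H.Carrier) λ g →
    (∀ x → g (f x) ≡ x) × (∀ y → f (g y) ≡ y) ×
    (∀ x y → f (x H.∙ y) ≡ (f x K.∙ f y))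
  where
  module H = MGroup H
  module K = MGroup K

record DivisionRing : Set₁ where
  field
    ring : Ring 0ℓ 0ℓ
  open Ring ring public using (Carrier; _≈_; 0#; 1#) renaming (_*_ to _·_)
  field
    0≉1     : ¬ (0# ≈ 1#)
    inverse : ∀ x → ¬ (x ≈ 0#) → ∃ λ y → (x · y ≈ 1#) × (y · x ≈ 1#)

-- An embedding of a group H into the multiplicative group D^× of a
-- division ring D: an injective map f : H → D with f(xy) = f(x) f(y)
-- and f(1) = 1 (its values are then units of D).

EmbedsInto : MGroup → DivisionRing → Set
EmbedsInto H D =
  Σ (H.Carrier → D.Carrier) λ f →
    (∀ x y → f (x H.∙ y) D.≈ (f x D.· f y)) ×
    (f H.ε D.≈ D.1#) ×
    (∀ x y → f x D.≈ f y → x ≡ y)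
  where
  module H = MGroup H
  module D = DivisionRing D

EmbedsInDivisionRing : MGroup → Set₁
EmbedsInDivisionRing H = Σ DivisionRing λ D → EmbedsInto H D

IsOrderMod : (m r n : ℕ) → .{{_ : NonZero m}} → Set
IsOrderMod m r n =
  (0 < n) × ((r ^ n) % m ≡ 1 % m) ×
  (∀ k → 0 < k → k < n → ¬ ((r ^ k) % m ≡ 1 % m))

{-# OPTIONS --safe #-}
-- The hypotheses leave m ∈ {4, 8, 12}, and G_{m,r} only depends on r mod m; what remains is
-- Q₈, Dic₁₆, Dic₂₄ or C₃ × Q₈ = G_{12,7}.  The first three embed into Hamilton's quaternions
-- over ℚ(√2) or ℚ(√3), with a ↦ a root of unity of ℚ(√p, i) and b ↦ j; these quaternion
-- algebras are division rings because √p is irrational and in the ordered field ℚ(√p) a sum of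
-- four squares vanishes only trivially.  C₃ × Q₈ embeds nowhere: a⁶ ↦ −1 and a⁴ ↦ a central ω
-- with ω² + ω + 1 = 0, so u = f(a⁷) and v = f(a¹⁰b) anticommute with u² + v² = −ω² − ω = 1.
-- Hence (u + v)² = 1 and u + v = ±1 commutes with f(a³), whereas f(a³) commutes with u and
-- anticommutes with v; this forces 2 v f(a³) = 0.  Nor is C₃ × Q₈ isomorphic to the other
-- three groups: it alone has a central element of order 3.  The finitely many facts about the
-- four concrete groups are decided by evaluation.
module Submission where

open import Level using (0ℓ)
open import Algebra.Core using (Op₁; Op₂)
open import Algebra.Bundles using (RawRing; Monoid; Ring; CommutativeRing)
open import Algebra.Structures using (IsRing; IsCommutativeRing)
open import Algebra.Definitions using (Congruent₂)
open import Algebra.Solver.Ring.AlmostCommutativeRing using (_-Raw-AlmostCommutative⟶_)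
  renaming (fromCommutativeRing to toAlmostCommutativeRing)
import Algebra.Solver.Ring
import Algebra.Properties.Monoid.Mult as MonoidPowers
import Algebra.Properties.Ring as RingProperties
import Algebra.Properties.CommutativeSemigroup as CommutativeSemigroupProperties
open import Data.Bool using (T; true; false; if_then_else_)
import Data.Nat as ℕ
open import Data.Nat using (ℕ; zero; suc; NonZero; NonTrivial; s≤s; z≤n)
import Data.Nat.Properties as ℕ
open import Data.Nat.DivMod using (_mod_; _%_; _/_)
import Data.Nat.DivMod as ℕ
open import Data.Nat.Divisibility using (_∣_; _∣?_; divides)
import Data.Nat.Divisibility as ℕ
open import Data.Nat.GCD using (gcd; gcd[m,n]∣m; gcd[m,n]∣n; gcd-greatest)
open import Data.Nat.Coprimality using (Coprime; coprime?; 1-coprimeTo) renaming (sym to coprime-sym)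
open import Data.Nat.Primality using (Prime; prime?; euclidsLemma; prime⇒nonZero; prime⇒nonTrivial)
open import Data.Nat.Induction using (<-wellFounded)
import Data.Nat.Tactic.RingSolver as ℕ-Solver
open import Data.Integer as ℤ using (+_; -[1+_]; ∣_∣)
import Data.Integer.Properties as ℤ
import Data.Integer.Tactic.RingSolver as ℤ-Solver
open import Data.Rational using (ℚ; mkℚ; 0ℚ; 1ℚ; ½; toℚᵘ; 1/_; ≢-nonZero; Positive; nonNegative)
import Data.Rational.Properties as ℚ-Properties
open import Data.Rational.Solver using (module +-*-Solver)
import Data.Rational.Unnormalised as ℚᵘ
import Data.Rational.Unnormalised.Properties as ℚᵘ
open import Data.Fin using (Fin; toℕ; #_)
import Data.Fin.Properties as Fin
open import Data.Vec using (Vec; []; _∷_)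
open import Data.Maybe using (Maybe; just; nothing)
open import Data.Product using (_×_; _,_; ∃; uncurry; curry)
import Data.Product.Properties as Product
open import Data.Sum using (_⊎_; inj₁; inj₂; [_,_]′)
open import Data.Empty using (⊥; ⊥-elim)
open import Function using (id)
open import Function.Bundles using (_⇔_; mk⇔)
open import Induction.WellFounded using (Acc; acc)
open import Relation.Nullary using (¬_; Dec; yes; no; contradiction)
open import Relation.Nullary.Decidable using (True; map′; toWitness; from-yes; from-no; ¬?; _×-dec_; _⊎-dec_; _→-dec_)
open import Relation.Unary as U using (Pred)
open import Relation.Binary.Core using (Rel)
open import Relation.Binary.Structures using (IsEquivalence)
open import Relation.Binary.Definitions using (Decidable; DecidableEquality)
open import Relation.Binary.PropositionalEquality as ≡ using (_≡_; _≢_; module ≡-Reasoning)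
open import Defs

-- Irrationality of √p

module _ {p : ℕ} (p-prime : Prime p) where
  open import Data.Nat using (_*_; _<_)
  open ≡ using (refl; sym; trans; cong)

  private instance
    p≢0 : NonZero p
    p≢0 = prime⇒nonZero p-prime
    p>1 : NonTrivial p
    p>1 = prime⇒nonTrivial p-prime

  prime∣m*m⇒prime∣m : ∀ {m} → p ∣ m * m → p ∣ m
  prime∣m*m⇒prime∣m {m} p∣m*m = [ id , id ]′ (euclidsLemma m m p-prime p∣m*m)

  m*m≡p*[n*n]⇒n≡0 : ∀ m n → m * m ≡ p * (n * n) → n ≡ 0
  m*m≡p*[n*n]⇒n≡0 m n = descent (<-wellFounded n) m
    where
    open ≡-Reasoning
    [x*p]*[x*p]≡p*[p*[x*x]] : ∀ x p → (x * p) * (x * p) ≡ p * (p * (x * x))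
    [x*p]*[x*p]≡p*[p*[x*x]] = ℕ-Solver.solve-∀
    descent : ∀ {n} → Acc _<_ n → ∀ m → m * m ≡ p * (n * n) → n ≡ 0
    descent {zero}      _         _ _  = refl
    descent {n@(suc _)} (acc rec) m eq = begin
      n     ≡⟨ n≡j*p ⟩
      j * p ≡⟨ cong (_* p) (descent (rec (ℕ.quotient-< p∣n)) k k*k≡p*[j*j]) ⟩
      0     ∎
      where
      p∣m : p ∣ m
      p∣m = prime∣m*m⇒prime∣m {m} (divides (n * n) (trans eq (ℕ.*-comm p (n * n))))
      k : ℕ
      k = _∣_.quotient p∣m
      p*[k*k]≡n*n : p * (k * k) ≡ n * n
      p*[k*k]≡n*n = ℕ.*-cancelˡ-≡ _ _ p (begin
        p * (p * (k * k)) ≡⟨ [x*p]*[x*p]≡p*[p*[x*x]] k p ⟨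
        (k * p) * (k * p) ≡⟨ cong (λ x → x * x) (ℕ.m∣n⇒n≡quotient*m p∣m) ⟨
        m * m             ≡⟨ eq ⟩
        p * (n * n)       ∎)
      p∣n : p ∣ n
      p∣n = prime∣m*m⇒prime∣m {n} (divides (k * k) (trans (sym p*[k*k]≡n*n) (ℕ.*-comm p (k * k))))
      j : ℕ
      j = _∣_.quotient p∣n
      n≡j*p : n ≡ j * p
      n≡j*p = ℕ.m∣n⇒n≡quotient*m p∣n
      k*k≡p*[j*j] : k * k ≡ p * (j * j)
      k*k≡p*[j*j] = ℕ.*-cancelˡ-≡ _ _ p (begin
        p * (k * k)       ≡⟨ p*[k*k]≡n*n ⟩
        n * n             ≡⟨ cong (λ x → x * x) n≡j*p ⟩
        (j * p) * (j * p) ≡⟨ [x*p]*[x*p]≡p*[p*[x*x]] j p ⟩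
        p * (p * (j * j)) ∎)

fromℕ : ℕ → ℚ
fromℕ n = mkℚ (+ n) 0 (coprime-sym (1-coprimeTo n))

fromℕ-positive : ∀ n .{{_ : NonZero n}} → Positive (fromℕ n)
fromℕ-positive (suc n) = _

module _ where
  open import Data.Rational using (_*_)
  open ≡ using (refl; sym; trans; cong)

  NonSquare : ℚ → Set
  NonSquare D = ∀ x y → x * x ≡ y * y * D → y ≡ 0ℚ

  prime⇒nonSquare : ∀ {p} → Prime p → NonSquare (fromℕ p)
  prime⇒nonSquare {p} p-prime x@(mkℚ a _ _) y@(mkℚ c _ _) eq
    with ℚᵘ.≃-trans (ℚᵘ.≃-sym (ℚ-Properties.toℚᵘ-homo-* x x))
           (ℚᵘ.≃-trans (ℚᵘ.≃-reflexive (cong toℚᵘ eq))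
             (ℚᵘ.≃-trans (ℚ-Properties.toℚᵘ-homo-* (y * y) (fromℕ p))
               (ℚᵘ.*-congʳ (ℚ-Properties.toℚᵘ-homo-* y y))))
  -- With x = a/b and y = c/d, clearing denominators turns x² = y² p into (a d)² = p (c b)².
  ... | ℚᵘ.*≡* eqᶻ = ℚ-Properties.↥p≡0⇒p≡0 y (c≡0 (ℤ.∣i∣≡0⇒i≡0 ∣c*b∣≡0))
    where
    b d : ℤ.ℤ
    b = + suc (ℚ.denominator-1 x)
    d = + suc (ℚ.denominator-1 y)
    open import Data.Integer using () renaming (_*_ to _*ᶻ_)
    open import Data.Nat using () renaming (_*_ to _*ⁿ_)
    [a*a]*[[d*d]*1]≡[a*d]*[a*d] : ∀ a d → (a *ᶻ a) *ᶻ ((d *ᶻ d) *ᶻ ℤ.1ℤ) ≡ (a *ᶻ d) *ᶻ (a *ᶻ d)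
    [a*a]*[[d*d]*1]≡[a*d]*[a*d] = ℤ-Solver.solve-∀
    [[c*c]*p]*[b*b]≡p*[[c*b]*[c*b]] : ∀ c b p → ((c *ᶻ c) *ᶻ p) *ᶻ (b *ᶻ b) ≡ p *ᶻ ((c *ᶻ b) *ᶻ (c *ᶻ b))
    [[c*c]*p]*[b*b]≡p*[[c*b]*[c*b]] = ℤ-Solver.solve-∀
    ∣a*d∣²≡p*∣c*b∣² : ∣ a *ᶻ d ∣ *ⁿ ∣ a *ᶻ d ∣ ≡ p *ⁿ (∣ c *ᶻ b ∣ *ⁿ ∣ c *ᶻ b ∣)
    ∣a*d∣²≡p*∣c*b∣² = begin
      ∣ a *ᶻ d ∣ *ⁿ ∣ a *ᶻ d ∣                 ≡⟨ ℤ.abs-* (a *ᶻ d) (a *ᶻ d) ⟨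
      ∣ (a *ᶻ d) *ᶻ (a *ᶻ d) ∣                 ≡⟨ cong ∣_∣ ([a*a]*[[d*d]*1]≡[a*d]*[a*d] a d) ⟨
      ∣ (a *ᶻ a) *ᶻ ((d *ᶻ d) *ᶻ ℤ.1ℤ) ∣       ≡⟨ cong ∣_∣ eqᶻ ⟩
      ∣ ((c *ᶻ c) *ᶻ + p) *ᶻ (b *ᶻ b) ∣        ≡⟨ cong ∣_∣ ([[c*c]*p]*[b*b]≡p*[[c*b]*[c*b]] c b (+ p)) ⟩
      ∣ + p *ᶻ ((c *ᶻ b) *ᶻ (c *ᶻ b)) ∣        ≡⟨ ℤ.abs-* (+ p) _ ⟩
      p *ⁿ ∣ (c *ᶻ b) *ᶻ (c *ᶻ b) ∣            ≡⟨ cong (p *ⁿ_) (ℤ.abs-* (c *ᶻ b) (c *ᶻ b)) ⟩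
      p *ⁿ (∣ c *ᶻ b ∣ *ⁿ ∣ c *ᶻ b ∣)          ∎
      where open ≡-Reasoning
    ∣c*b∣≡0 : ∣ c *ᶻ b ∣ ≡ 0
    ∣c*b∣≡0 = m*m≡p*[n*n]⇒n≡0 p-prime ∣ a *ᶻ d ∣ ∣ c *ᶻ b ∣ ∣a*d∣²≡p*∣c*b∣²
    c≡0 : c *ᶻ b ≡ ℤ.0ℤ → c ≡ ℤ.0ℤ
    c≡0 c*b≡0 = [ id , (λ ()) ]′ (ℤ.i*j≡0⇒i≡0∨j≡0 c c*b≡0)

-- The quadratic fields ℚ(√D)

module _ where
  open import Data.Rational using (_+_; _*_; _≤_)
  open ℚ-Properties using (_≟_; ≤-antisym; +-monoʳ-≤; +-comm; +-identityʳ; *-identityˡ; *-inverseˡ;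
                           *-assoc; *-zeroʳ; nonNegative⁻¹; nonNeg*nonNeg⇒nonNeg; nonPos*nonPos⇒nonPos)
  open ≡ using (trans; cong)

  0≤p*p : ∀ p → 0ℚ ≤ p * p
  0≤p*p p@(mkℚ (+ _)     _ _) = nonNegative⁻¹ _ {{nonNeg*nonNeg⇒nonNeg p p}}
  0≤p*p p@(mkℚ -[1+ _ ] _ _) = nonNegative⁻¹ _ {{nonPos*nonPos⇒nonPos p p}}

  p*q≡0⇒p≡0∨q≡0 : ∀ p q → p * q ≡ 0ℚ → p ≡ 0ℚ ⊎ q ≡ 0ℚ
  p*q≡0⇒p≡0∨q≡0 p q p*q≡0 with p ≟ 0ℚ
  ... | yes p≡0 = inj₁ p≡0
  ... | no  p≢0 = inj₂ (begin
    q                ≡⟨ *-identityˡ q ⟨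
    1ℚ * q           ≡⟨ cong (_* q) (*-inverseˡ p) ⟨
    (1/ p * p) * q   ≡⟨ *-assoc (1/ p) p q ⟩
    1/ p * (p * q)   ≡⟨ cong (1/ p *_) p*q≡0 ⟩
    1/ p * 0ℚ        ≡⟨ *-zeroʳ (1/ p) ⟩
    0ℚ               ∎)
    where
    open ≡-Reasoning
    instance
      p-nonZero : Data.Rational.NonZero p
      p-nonZero = ≢-nonZero p≢0

  p+q≡0⇒p≡0∧q≡0 : ∀ {p q} → 0ℚ ≤ p → 0ℚ ≤ q → p + q ≡ 0ℚ → p ≡ 0ℚ × q ≡ 0ℚ
  p+q≡0⇒p≡0∧q≡0 {p} {q} 0≤p 0≤q p+q≡0 =
    ≤-antisym (p+q≡0⇒p≤0 p q 0≤q p+q≡0) 0≤p ,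
    ≤-antisym (p+q≡0⇒p≤0 q p 0≤p (trans (+-comm q p) p+q≡0)) 0≤q
    where
    p+q≡0⇒p≤0 : ∀ p q → 0ℚ ≤ q → p + q ≡ 0ℚ → p ≤ 0ℚ
    p+q≡0⇒p≤0 p q 0≤q p+q≡0 = begin
      p      ≡⟨ +-identityʳ p ⟨
      p + 0ℚ ≤⟨ +-monoʳ-≤ p 0≤q ⟩
      p + q  ≡⟨ p+q≡0 ⟩
      0ℚ     ∎
      where open ℚ-Properties.≤-Reasoning

infix 5 _+_√D

-- A record rather than a data type: with η, the closed computations in quaternions over
-- ℚ(√D) further down stay fast.
record Quadratic {a} (A : Set a) : Set a where
  constructor _+_√D
  field
    rat surd : A

open Quadratic public

-- Stated for any ring of coefficients so that the same formulas, read in the ring solver's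
-- syntax of polynomials, produce the solver's goals.
module QuadraticProduct {c ℓ} (R : RawRing c ℓ) (D : RawRing.Carrier R) where
  open RawRing R

  infixl 6 _⊕_
  infixl 7 _⊗_
  infix  8 ⊝_

  _⊕_ _⊗_ : Op₂ (Quadratic Carrier)
  (a + b √D) ⊕ (c + e √D) = (a + c) + (b + e) √D
  (a + b √D) ⊗ (c + e √D) = (a * c + b * e * D) + (a * e + b * c) √D

  ⊝_ : Op₁ (Quadratic Carrier)
  ⊝ (a + b √D) = (- a) + (- b) √D

  𝟘 𝟙 : Quadratic Carrier
  𝟘 = 0# + 0# √D
  𝟙 = 1# + 0# √D

module QuadraticField (D : ℚ) where
  open import Data.Rational using (_+_; _*_; -_; _-_; _≤_)
  open ℚ-Properties using (+-*-rawRing; +-0-group; +-mono-≤; *-zeroˡ; *-inverseʳ; <-irrefl;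
                           positive⁻¹; pos⇒nonNeg; nonNegative⁻¹; nonNeg*nonNeg⇒nonNeg)
                    renaming (_≟_ to _≟ℚ_)
  open import Algebra.Properties.Group +-0-group using (x∙y⁻¹≈ε⇒x≈y)
  open +-*-Solver using (Polynomial; con; var; _:+_; _:*_; :-_; _:-_; _:=_; solve; prove; ⟦_⟧; ⟦_⟧↓)
  open ≡ using (refl; sym; trans; cong; cong₂; isEquivalence)

  ℚ[√D] : Set
  ℚ[√D] = Quadratic ℚ

  open QuadraticProduct +-*-rawRing D public

  private
    polynomials : RawRing 0ℓ 0ℓ
    polynomials = record
      { Carrier = Polynomial 7 ; _≈_ = _≡_ ; _+_ = _:+_ ; _*_ = _:*_ ; -_ = :-_
      ; 0# = con 0ℚ ; 1# = con 1ℚ }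

    open module Syntax = QuadraticProduct polynomials (var (# 6))
      using () renaming (_⊕_ to _⊕ₚ_; _⊗_ to _⊗ₚ_; ⊝_ to ⊝ₚ_; 𝟘 to 𝟘ₚ; 𝟙 to 𝟙ₚ)

    ⟦_⟧√ ⟦_⟧√↓ : Quadratic (Polynomial 7) → Vec ℚ 7 → ℚ[√D]
    ⟦ a + b √D ⟧√  ρ = ⟦ a ⟧ ρ + ⟦ b ⟧ ρ √D
    ⟦ a + b √D ⟧√↓ ρ = ⟦ a ⟧↓ ρ + ⟦ b ⟧↓ ρ √D

    prove-√ : ∀ p q ρ → ⟦ p ⟧√↓ ρ ≡ ⟦ q ⟧√↓ ρ → ⟦ p ⟧√ ρ ≡ ⟦ q ⟧√ ρ
    prove-√ (a + b √D) (a′ + b′ √D) ρ eq =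
      cong₂ _+_√D (prove ρ a a′ (cong rat eq)) (prove ρ b b′ (cong surd eq))

    X Y Z : Quadratic (Polynomial 7)
    X = var (# 0) + var (# 1) √D
    Y = var (# 2) + var (# 3) √D
    Z = var (# 4) + var (# 5) √D

    env : ℚ[√D] → ℚ[√D] → ℚ[√D] → Vec ℚ 7
    env (a + b √D) (c + e √D) (f + g √D) = a ∷ b ∷ c ∷ e ∷ f ∷ g ∷ D ∷ []

  isCommutativeRing : IsCommutativeRing _≡_ _⊕_ _⊗_ ⊝_ 𝟘 𝟙
  isCommutativeRing = record
    { isRing = record
      { +-isAbelianGroup = record
        { isGroup = record
          { isMonoid = record
            { isSemigroup = record
              { isMagma = record { isEquivalence = isEquivalence ; ∙-cong = cong₂ _⊕_ }
              ; assoc = λ x y z → prove-√ ((X ⊕ₚ Y) ⊕ₚ Z) (X ⊕ₚ (Y ⊕ₚ Z)) (env x y z) refl }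
            ; identity = (λ x → prove-√ (𝟘ₚ ⊕ₚ X) X (env x x x) refl)
                       , (λ x → prove-√ (X ⊕ₚ 𝟘ₚ) X (env x x x) refl) }
          ; inverse = (λ x → prove-√ (⊝ₚ X ⊕ₚ X) 𝟘ₚ (env x x x) refl)
                    , (λ x → prove-√ (X ⊕ₚ ⊝ₚ X) 𝟘ₚ (env x x x) refl)
          ; ⁻¹-cong = cong ⊝_ }
        ; comm = λ x y → prove-√ (X ⊕ₚ Y) (Y ⊕ₚ X) (env x y x) refl }
      ; *-cong = cong₂ _⊗_
      ; *-assoc = λ x y z → prove-√ ((X ⊗ₚ Y) ⊗ₚ Z) (X ⊗ₚ (Y ⊗ₚ Z)) (env x y z) refl
      ; *-identity = (λ x → prove-√ (𝟙ₚ ⊗ₚ X) X (env x x x) refl)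
                   , (λ x → prove-√ (X ⊗ₚ 𝟙ₚ) X (env x x x) refl)
      ; distrib = (λ x y z → prove-√ (X ⊗ₚ (Y ⊕ₚ Z)) (X ⊗ₚ Y ⊕ₚ X ⊗ₚ Z) (env x y z) refl)
                , (λ x y z → prove-√ ((Y ⊕ₚ Z) ⊗ₚ X) (Y ⊗ₚ X ⊕ₚ Z ⊗ₚ X) (env x y z) refl)
      }
    ; *-comm = λ x y → prove-√ (X ⊗ₚ Y) (Y ⊗ₚ X) (env x y x) refl
    }

  commutativeRing : CommutativeRing 0ℓ 0ℓ
  commutativeRing = record { isCommutativeRing = isCommutativeRing }

  ι : ℚ → ℚ[√D]
  ι a = a + 0ℚ √D

  ι-homomorphism : +-*-rawRing -Raw-AlmostCommutative⟶ toAlmostCommutativeRing commutativeRing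
  ι-homomorphism = record
    { ⟦_⟧    = ι
    ; +-homo = λ a b → prove-√ (ιₚ (var (# 0) :+ var (# 2))) (ιₚ (var (# 0)) ⊕ₚ ιₚ (var (# 2)))
                                (env (ι a) (ι b) 𝟘) refl
    ; *-homo = λ a b → prove-√ (ιₚ (var (# 0) :* var (# 2))) (ιₚ (var (# 0)) ⊗ₚ ιₚ (var (# 2)))
                                (env (ι a) (ι b) 𝟘) refl
    ; -‿homo = λ a → refl
    ; 0-homo = refl
    ; 1-homo = refl
    }
    where
    ιₚ : Polynomial 7 → Quadratic (Polynomial 7)
    ιₚ a = a + con 0ℚ √D

  _≟_ : DecidableEquality ℚ[√D]
  (a + b √D) ≟ (c + e √D) =
    map′ (λ (a≡c , b≡e) → cong₂ _+_√D a≡c b≡e) (λ { refl → refl , refl }) ((a ≟ℚ c) ×-dec (b ≟ℚ e))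

  ⊗-inverseʳ : NonSquare D → ∀ u → u ≢ 𝟘 → ∃ λ v → u ⊗ v ≡ 𝟙
  ⊗-inverseʳ nonSquare (a + b √D) u≢𝟘 =
    (a * δ⁻¹) + (- b * δ⁻¹) √D ,
    cong₂ _+_√D
      (trans (solve 4 (λ a b D i → a :* (a :* i) :+ b :* (:- b :* i) :* D := (a :* a :- b :* b :* D) :* i)
                    refl a b D δ⁻¹)
             (*-inverseʳ δ))
      (solve 3 (λ a b i → a :* (:- b :* i) :+ b :* (a :* i) := con 0ℚ) refl a b δ⁻¹)
    where
    δ : ℚ
    δ = a * a - b * b * D
    δ≢0 : δ ≢ 0ℚ
    δ≢0 δ≡0 = u≢𝟘 (cong₂ _+_√D a≡0 b≡0)
      where
      a*a≡b*b*D : a * a ≡ b * b * D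
      a*a≡b*b*D = x∙y⁻¹≈ε⇒x≈y (a * a) (b * b * D) δ≡0
      b≡0 : b ≡ 0ℚ
      b≡0 = nonSquare a b a*a≡b*b*D
      a≡0 : a ≡ 0ℚ
      a≡0 = [ id , id ]′ (p*q≡0⇒p≡0∨q≡0 a a
              (trans a*a≡b*b*D (trans (cong (λ x → x * x * D) b≡0) (*-zeroˡ D))))
    instance
      δ-nonZero : Data.Rational.NonZero δ
      δ-nonZero = ≢-nonZero δ≢0
    δ⁻¹ : ℚ
    δ⁻¹ = 1/ δ

  module _ .{{_ : Positive D}} where

    0≤b*b*D : ∀ b → 0ℚ ≤ b * b * D
    0≤b*b*D b = nonNegative⁻¹ _ {{nonNeg*nonNeg⇒nonNeg (b * b) {{nonNegative (0≤p*p b)}} D {{pos⇒nonNeg D}}}}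

    0≤rat[u⊗u] : ∀ u → 0ℚ ≤ rat (u ⊗ u)
    0≤rat[u⊗u] (a + b √D) = +-mono-≤ (0≤p*p a) (0≤b*b*D b)

    rat[u⊗u]≡0⇒u≡𝟘 : ∀ u → rat (u ⊗ u) ≡ 0ℚ → u ≡ 𝟘
    rat[u⊗u]≡0⇒u≡𝟘 (a + b √D) a*a+b*b*D≡0 with p+q≡0⇒p≡0∧q≡0 (0≤p*p a) (0≤b*b*D b) a*a+b*b*D≡0
    ... | a*a≡0 , b*b*D≡0 = cong₂ _+_√D (square≡0 a a*a≡0) (square≡0 b b*b≡0)
      where
      square≡0 : ∀ x → x * x ≡ 0ℚ → x ≡ 0ℚ
      square≡0 x x*x≡0 = [ id , id ]′ (p*q≡0⇒p≡0∨q≡0 x x x*x≡0)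
      b*b≡0 : b * b ≡ 0ℚ
      b*b≡0 = [ id , (λ D≡0 → contradiction (positive⁻¹ D) (<-irrefl (sym D≡0))) ]′
                (p*q≡0⇒p≡0∨q≡0 (b * b) D b*b*D≡0)

    0≤rat[u⊗u⊕v⊗v] : ∀ u v → 0ℚ ≤ rat (u ⊗ u ⊕ v ⊗ v)
    0≤rat[u⊗u⊕v⊗v] u v = +-mono-≤ (0≤rat[u⊗u] u) (0≤rat[u⊗u] v)

    sum-of-squares≡𝟘 : ∀ a b c e → a ⊗ a ⊕ b ⊗ b ⊕ c ⊗ c ⊕ e ⊗ e ≡ 𝟘 →
                       a ≡ 𝟘 × b ≡ 𝟘 × c ≡ 𝟘 × e ≡ 𝟘
    sum-of-squares≡𝟘 a b c e eq
      with p+q≡0⇒p≡0∧q≡0 (+-mono-≤ (0≤rat[u⊗u⊕v⊗v] a b) (0≤rat[u⊗u] c)) (0≤rat[u⊗u] e) (cong rat eq)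
    ... | a²+b²+c²≡0 , e²≡0 with p+q≡0⇒p≡0∧q≡0 (0≤rat[u⊗u⊕v⊗v] a b) (0≤rat[u⊗u] c) a²+b²+c²≡0
    ... | a²+b²≡0 , c²≡0 with p+q≡0⇒p≡0∧q≡0 (0≤rat[u⊗u] a) (0≤rat[u⊗u] b) a²+b²≡0
    ... | a²≡0 , b²≡0 =
      rat[u⊗u]≡0⇒u≡𝟘 a a²≡0 , rat[u⊗u]≡0⇒u≡𝟘 b b²≡0 , rat[u⊗u]≡0⇒u≡𝟘 c c²≡0 , rat[u⊗u]≡0⇒u≡𝟘 e e²≡0

-- Hamilton's quaternions

infix 5 _+_𝐢+_𝐣+_𝐤

record Quaternion {a} (A : Set a) : Set a where
  constructor _+_𝐢+_𝐣+_𝐤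
  field
    re im₁ im₂ im₃ : A

open Quaternion public

module HamiltonProduct {c ℓ} (R : RawRing c ℓ) where
  open RawRing R

  infixl 6 _-_ _⊕_
  infixl 7 _⊗_ _⊛_

  _-_ : Op₂ Carrier
  x - y = x + - y

  _⊕_ _⊗_ : Op₂ (Quaternion Carrier)
  (a + b 𝐢+ c 𝐣+ d 𝐤) ⊕ (a′ + b′ 𝐢+ c′ 𝐣+ d′ 𝐤) =
    (a + a′) + (b + b′) 𝐢+ (c + c′) 𝐣+ (d + d′) 𝐤
  (a + b 𝐢+ c 𝐣+ d 𝐤) ⊗ (a′ + b′ 𝐢+ c′ 𝐣+ d′ 𝐤) =
    (a * a′ - b * b′ - c * c′ - d * d′) + (a * b′ + b * a′ + c * d′ - d * c′) 𝐢+
    (a * c′ - b * d′ + c * a′ + d * b′) 𝐣+ (a * d′ + b * c′ - c * b′ + d * a′) 𝐤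

  ⊝_ conj : Op₁ (Quaternion Carrier)
  ⊝ (a + b 𝐢+ c 𝐣+ d 𝐤) = (- a) + (- b) 𝐢+ (- c) 𝐣+ (- d) 𝐤
  conj (a + b 𝐢+ c 𝐣+ d 𝐤) = a + (- b) 𝐢+ (- c) 𝐣+ (- d) 𝐤

  ⟨_⟩ : Carrier → Quaternion Carrier
  ⟨ a ⟩ = a + 0# 𝐢+ 0# 𝐣+ 0# 𝐤

  _⊛_ : Quaternion Carrier → Carrier → Quaternion Carrier
  (a + b 𝐢+ c 𝐣+ d 𝐤) ⊛ s = (a * s) + (b * s) 𝐢+ (c * s) 𝐣+ (d * s) 𝐤

  norm : Quaternion Carrier → Carrier
  norm (a + b 𝐢+ c 𝐣+ d 𝐤) = a * a + b * b + c * c + d * d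

module Quaternions (F : CommutativeRing 0ℓ 0ℓ)
                   (ι : ℚ-Properties.+-*-rawRing -Raw-AlmostCommutative⟶ toAlmostCommutativeRing F) where
  open CommutativeRing F
    using (Carrier; rawRing; _≈_; _+_; _*_; -_; _-_; 0#; 1#; refl; sym; trans; reflexive; +-cong; *-cong; -‿cong)
  open _-Raw-AlmostCommutative⟶_ ι using (⟦_⟧; 0-homo; 1-homo)

  private
    coefficient≟ : ∀ p q → Maybe (⟦ p ⟧ ≈ ⟦ q ⟧)
    coefficient≟ p q with p ℚ-Properties.≟ q
    ... | yes ≡.refl = just refl
    ... | no _       = nothing

  open Algebra.Solver.Ring ℚ-Properties.+-*-rawRing (toAlmostCommutativeRing F) ι coefficient≟
    using (Polynomial; con; var; _:+_; _:*_; :-_; prove) renaming (⟦_⟧ to ⟦_⟧ₚ; ⟦_⟧↓ to ⟦_⟧ₚ↓)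

  ℍ : Set
  ℍ = Quaternion Carrier

  -- 0 and 1 are taken as images of rationals, the constants of the ring solver, so that it
  -- recognises them.
  coefficients : RawRing 0ℓ 0ℓ
  coefficients = record { RawRing rawRing ; 0# = ⟦ 0ℚ ⟧ ; 1# = ⟦ 1ℚ ⟧ }

  open HamiltonProduct coefficients public using (_⊕_; _⊗_; ⊝_; conj; ⟨_⟩; _⊛_; norm)

  0ℍ 1ℍ : ℍ
  0ℍ = ⟨ ⟦ 0ℚ ⟧ ⟩
  1ℍ = ⟨ ⟦ 1ℚ ⟧ ⟩

  infix 4 _≈ℍ_
  _≈ℍ_ : Rel ℍ 0ℓ
  (a + b 𝐢+ c 𝐣+ d 𝐤) ≈ℍ (a′ + b′ 𝐢+ c′ 𝐣+ d′ 𝐤) = a ≈ a′ × b ≈ b′ × c ≈ c′ × d ≈ d′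

  ≈ℍ-dec : Decidable _≈_ → Decidable _≈ℍ_
  ≈ℍ-dec _≈?_ (a + b 𝐢+ c 𝐣+ d 𝐤) (a′ + b′ 𝐢+ c′ 𝐣+ d′ 𝐤) =
    (a ≈? a′) ×-dec (b ≈? b′) ×-dec (c ≈? c′) ×-dec (d ≈? d′)

  private
    polynomials : ℕ → RawRing 0ℓ 0ℓ
    polynomials n = record
      { Carrier = Polynomial n ; _≈_ = _≡_ ; _+_ = _:+_ ; _*_ = _:*_ ; -_ = :-_
      ; 0# = con 0ℚ ; 1# = con 1ℚ }

    open module Syntax {n} = HamiltonProduct (polynomials n)
      using () renaming (_⊕_ to _⊕ₚ_; _⊗_ to _⊗ₚ_; ⊝_ to ⊝ₚ_; conj to conjₚ; ⟨_⟩ to ⟨_⟩ₚ;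
                         _⊛_ to _⊛ₚ_; norm to normₚ)

    ⟦_⟧ℍ ⟦_⟧ℍ↓ : ∀ {n} → Quaternion (Polynomial n) → Vec Carrier n → ℍ
    ⟦ a + b 𝐢+ c 𝐣+ d 𝐤 ⟧ℍ  ρ = ⟦ a ⟧ₚ ρ + ⟦ b ⟧ₚ ρ 𝐢+ ⟦ c ⟧ₚ ρ 𝐣+ ⟦ d ⟧ₚ ρ 𝐤
    ⟦ a + b 𝐢+ c 𝐣+ d 𝐤 ⟧ℍ↓ ρ = ⟦ a ⟧ₚ↓ ρ + ⟦ b ⟧ₚ↓ ρ 𝐢+ ⟦ c ⟧ₚ↓ ρ 𝐣+ ⟦ d ⟧ₚ↓ ρ 𝐤

    prove-ℍ : ∀ {n} (p q : Quaternion (Polynomial n)) ρ →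
              ⟦ p ⟧ℍ↓ ρ ≡ ⟦ q ⟧ℍ↓ ρ → ⟦ p ⟧ℍ ρ ≈ℍ ⟦ q ⟧ℍ ρ
    prove-ℍ (a + b 𝐢+ c 𝐣+ d 𝐤) (a′ + b′ 𝐢+ c′ 𝐣+ d′ 𝐤) ρ eq =
      prove ρ a a′ (reflexive (≡.cong re eq)) , prove ρ b b′ (reflexive (≡.cong im₁ eq)) ,
      prove ρ c c′ (reflexive (≡.cong im₂ eq)) , prove ρ d d′ (reflexive (≡.cong im₃ eq))

    X Y Z : Quaternion (Polynomial 12)
    X = var (# 0) + var (# 1) 𝐢+ var (# 2)  𝐣+ var (# 3)  𝐤
    Y = var (# 4) + var (# 5) 𝐢+ var (# 6)  𝐣+ var (# 7)  𝐤
    Z = var (# 8) + var (# 9) 𝐢+ var (# 10) 𝐣+ var (# 11) 𝐤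

    env : ℍ → ℍ → ℍ → Vec Carrier 12
    env (a₁ + b₁ 𝐢+ c₁ 𝐣+ d₁ 𝐤) (a₂ + b₂ 𝐢+ c₂ 𝐣+ d₂ 𝐤) (a₃ + b₃ 𝐢+ c₃ 𝐣+ d₃ 𝐤) =
      a₁ ∷ b₁ ∷ c₁ ∷ d₁ ∷ a₂ ∷ b₂ ∷ c₂ ∷ d₂ ∷ a₃ ∷ b₃ ∷ c₃ ∷ d₃ ∷ []

  ≈ℍ-refl : ∀ {x} → x ≈ℍ x
  ≈ℍ-refl = refl , refl , refl , refl

  ≈ℍ-isEquivalence : IsEquivalence _≈ℍ_
  ≈ℍ-isEquivalence = record
    { refl  = ≈ℍ-refl
    ; sym   = λ (a , b , c , d) → sym a , sym b , sym c , sym d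
    ; trans = λ (a , b , c , d) (a′ , b′ , c′ , d′) → trans a a′ , trans b b′ , trans c c′ , trans d d′
    }

  ⊕-cong : ∀ {x x′ y y′} → x ≈ℍ x′ → y ≈ℍ y′ → x ⊕ y ≈ℍ x′ ⊕ y′
  ⊕-cong (a , b , c , d) (a′ , b′ , c′ , d′) = +-cong a a′ , +-cong b b′ , +-cong c c′ , +-cong d d′

  ⊝-cong : ∀ {x x′} → x ≈ℍ x′ → ⊝ x ≈ℍ ⊝ x′
  ⊝-cong (a , b , c , d) = -‿cong a , -‿cong b , -‿cong c , -‿cong d

  ⊗-cong : ∀ {x x′ y y′} → x ≈ℍ x′ → y ≈ℍ y′ → x ⊗ y ≈ℍ x′ ⊗ y′
  ⊗-cong (a , b , c , d) (a′ , b′ , c′ , d′) =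
    a ⊠ a′ ⊟ b ⊠ b′ ⊟ c ⊠ c′ ⊟ d ⊠ d′ , a ⊠ b′ ⊞ b ⊠ a′ ⊞ c ⊠ d′ ⊟ d ⊠ c′ ,
    a ⊠ c′ ⊟ b ⊠ d′ ⊞ c ⊠ a′ ⊞ d ⊠ b′ , a ⊠ d′ ⊞ b ⊠ c′ ⊟ c ⊠ b′ ⊞ d ⊠ a′
    where
    infixl 6 _⊞_ _⊟_
    infixl 7 _⊠_
    _⊞_ : Congruent₂ _≈_ _+_
    _⊞_ = +-cong
    _⊟_ : Congruent₂ _≈_ _-_
    p ⊟ q = +-cong p (-‿cong q)
    _⊠_ : Congruent₂ _≈_ _*_
    _⊠_ = *-cong

  ⊕-assoc : ∀ x y z → (x ⊕ y) ⊕ z ≈ℍ x ⊕ (y ⊕ z)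
  ⊕-assoc x y z = prove-ℍ ((X ⊕ₚ Y) ⊕ₚ Z) (X ⊕ₚ (Y ⊕ₚ Z)) (env x y z) ≡.refl

  ⊕-comm : ∀ x y → x ⊕ y ≈ℍ y ⊕ x
  ⊕-comm x y = prove-ℍ (X ⊕ₚ Y) (Y ⊕ₚ X) (env x y x) ≡.refl

  ⊕-identityˡ : ∀ x → 0ℍ ⊕ x ≈ℍ x
  ⊕-identityˡ x = prove-ℍ (⟨ con 0ℚ ⟩ₚ ⊕ₚ X) X (env x x x) ≡.refl

  ⊕-identityʳ : ∀ x → x ⊕ 0ℍ ≈ℍ x
  ⊕-identityʳ x = prove-ℍ (X ⊕ₚ ⟨ con 0ℚ ⟩ₚ) X (env x x x) ≡.refl

  ⊝-inverseˡ : ∀ x → ⊝ x ⊕ x ≈ℍ 0ℍ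
  ⊝-inverseˡ x = prove-ℍ (⊝ₚ X ⊕ₚ X) ⟨ con 0ℚ ⟩ₚ (env x x x) ≡.refl

  ⊝-inverseʳ : ∀ x → x ⊕ ⊝ x ≈ℍ 0ℍ
  ⊝-inverseʳ x = prove-ℍ (X ⊕ₚ ⊝ₚ X) ⟨ con 0ℚ ⟩ₚ (env x x x) ≡.refl

  ⊗-assoc : ∀ x y z → (x ⊗ y) ⊗ z ≈ℍ x ⊗ (y ⊗ z)
  ⊗-assoc x y z = prove-ℍ ((X ⊗ₚ Y) ⊗ₚ Z) (X ⊗ₚ (Y ⊗ₚ Z)) (env x y z) ≡.refl

  ⊗-identityˡ : ∀ x → 1ℍ ⊗ x ≈ℍ x
  ⊗-identityˡ x = prove-ℍ (⟨ con 1ℚ ⟩ₚ ⊗ₚ X) X (env x x x) ≡.refl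

  ⊗-identityʳ : ∀ x → x ⊗ 1ℍ ≈ℍ x
  ⊗-identityʳ x = prove-ℍ (X ⊗ₚ ⟨ con 1ℚ ⟩ₚ) X (env x x x) ≡.refl

  ⊗-distribˡ-⊕ : ∀ x y z → x ⊗ (y ⊕ z) ≈ℍ x ⊗ y ⊕ x ⊗ z
  ⊗-distribˡ-⊕ x y z = prove-ℍ (X ⊗ₚ (Y ⊕ₚ Z)) (X ⊗ₚ Y ⊕ₚ X ⊗ₚ Z) (env x y z) ≡.refl

  ⊗-distribʳ-⊕ : ∀ x y z → (y ⊕ z) ⊗ x ≈ℍ y ⊗ x ⊕ z ⊗ x
  ⊗-distribʳ-⊕ x y z = prove-ℍ ((Y ⊕ₚ Z) ⊗ₚ X) (Y ⊗ₚ X ⊕ₚ Z ⊗ₚ X) (env x y z) ≡.refl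

  x⊗[conj[x]⊛s]≈⟨norm[x]*s⟩ : ∀ x s → x ⊗ (conj x ⊛ s) ≈ℍ ⟨ norm x * s ⟩
  x⊗[conj[x]⊛s]≈⟨norm[x]*s⟩ x s =
    prove-ℍ (X ⊗ₚ (conjₚ X ⊛ₚ re Y)) ⟨ normₚ X :* re Y ⟩ₚ (env x ⟨ s ⟩ x) ≡.refl

  [conj[x]⊛s]⊗x≈⟨norm[x]*s⟩ : ∀ x s → (conj x ⊛ s) ⊗ x ≈ℍ ⟨ norm x * s ⟩
  [conj[x]⊛s]⊗x≈⟨norm[x]*s⟩ x s =
    prove-ℍ ((conjₚ X ⊛ₚ re Y) ⊗ₚ X) ⟨ normₚ X :* re Y ⟩ₚ (env x ⟨ s ⟩ x) ≡.refl

  isRing : IsRing _≈ℍ_ _⊕_ _⊗_ ⊝_ 0ℍ 1ℍ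
  isRing = record
    { +-isAbelianGroup = record
      { isGroup = record
        { isMonoid = record
          { isSemigroup = record
            { isMagma = record { isEquivalence = ≈ℍ-isEquivalence ; ∙-cong = ⊕-cong }
            ; assoc = ⊕-assoc }
          ; identity = ⊕-identityˡ , ⊕-identityʳ }
        ; inverse = ⊝-inverseˡ , ⊝-inverseʳ
        ; ⁻¹-cong = ⊝-cong }
      ; comm = ⊕-comm }
    ; *-cong = ⊗-cong
    ; *-assoc = ⊗-assoc
    ; *-identity = ⊗-identityˡ , ⊗-identityʳ
    ; distrib = ⊗-distribˡ-⊕ , ⊗-distribʳ-⊕
    }

  ring : Ring 0ℓ 0ℓ
  ring = record { isRing = isRing }

  module _ (0≉1 : ¬ 0# ≈ 1#)
           (*-inverseʳ : ∀ x → ¬ x ≈ 0# → ∃ λ y → x * y ≈ 1#)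
           (sum-of-squares≈0 : ∀ a b c d → a * a + b * b + c * c + d * d ≈ 0# →
                               a ≈ 0# × b ≈ 0# × c ≈ 0# × d ≈ 0#)
           where

    norm≈0⇒x≈0 : ∀ x → norm x ≈ 0# → x ≈ℍ 0ℍ
    norm≈0⇒x≈0 (a + b 𝐢+ c 𝐣+ d 𝐤) norm≈0 with sum-of-squares≈0 a b c d norm≈0
    ... | a≈0 , b≈0 , c≈0 , d≈0 = ≈⟦0⟧ a≈0 , ≈⟦0⟧ b≈0 , ≈⟦0⟧ c≈0 , ≈⟦0⟧ d≈0
      where
      ≈⟦0⟧ : ∀ {x} → x ≈ 0# → x ≈ ⟦ 0ℚ ⟧
      ≈⟦0⟧ x≈0 = trans x≈0 (sym 0-homo)

    ⊗-inverse : ∀ x → ¬ x ≈ℍ 0ℍ → ∃ λ y → x ⊗ y ≈ℍ 1ℍ × y ⊗ x ≈ℍ 1ℍ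
    ⊗-inverse x x≉0 with *-inverseʳ (norm x) (λ norm≈0 → x≉0 (norm≈0⇒x≈0 x norm≈0))
    ... | s , norm*s≈1 =
      conj x ⊛ s ,
      ≈ℍ.trans (x⊗[conj[x]⊛s]≈⟨norm[x]*s⟩ x s) ⟨norm*s⟩≈1ℍ ,
      ≈ℍ.trans ([conj[x]⊛s]⊗x≈⟨norm[x]*s⟩ x s) ⟨norm*s⟩≈1ℍ
      where
      module ≈ℍ = IsEquivalence ≈ℍ-isEquivalence
      ⟨norm*s⟩≈1ℍ : ⟨ norm x * s ⟩ ≈ℍ 1ℍ
      ⟨norm*s⟩≈1ℍ = trans norm*s≈1 (sym 1-homo) , refl , refl , refl

    divisionRing : DivisionRing
    divisionRing = record
      { ring    = ring
      ; 0≉1     = λ (0≈1 , _) → 0≉1 (trans (sym 0-homo) (trans 0≈1 1-homo))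
      ; inverse = ⊗-inverse
      }

-- Metacyclic groups

toℕ-mod : ∀ a m .{{_ : NonZero m}} → toℕ (a mod m) ≡ a % m
toℕ-mod a m = Fin.toℕ-fromℕ< (ℕ.m%n<n a m)

module PresentationMap {c ℓ} (M : Monoid c ℓ) where
  open Monoid M
  open MonoidPowers M using (×-homo-+) renaming (_×_ to _×ᴹ_)
  open import Data.Nat using (_+_; _*_; _^_; _∸_; _<_; _≤ᵇ_)
  open import Relation.Binary.Reasoning.Setoid setoid

  infixr 8 _^ᴹ_
  _^ᴹ_ : Carrier → ℕ → Carrier
  x ^ᴹ n = n ×ᴹ x

  ^ᴹ-+ : ∀ x a b → x ^ᴹ (a + b) ≈ x ^ᴹ a ∙ x ^ᴹ b
  ^ᴹ-+ x = ×-homo-+ x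

  substitute : ∀ {m n} → Carrier → Carrier → Fin m × Fin n → Carrier
  substitute A B (i , j) = A ^ᴹ toℕ i ∙ B ^ᴹ toℕ j

  module _ {m n r t} .{{_ : NonZero m}} .{{_ : NonZero n}} {A B : Carrier}
           (A^m≈ε : A ^ᴹ m ≈ ε) (B^n≈A^t : B ^ᴹ n ≈ A ^ᴹ t) (B∙A≈A^r∙B : B ∙ A ≈ A ^ᴹ r ∙ B) where

    A^[k*m]≈ε : ∀ k → A ^ᴹ (k * m) ≈ ε
    A^[k*m]≈ε zero    = refl
    A^[k*m]≈ε (suc k) = begin
      A ^ᴹ (m + k * m)        ≈⟨ ^ᴹ-+ A m (k * m) ⟩
      A ^ᴹ m ∙ A ^ᴹ (k * m)   ≈⟨ ∙-cong A^m≈ε (A^[k*m]≈ε k) ⟩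
      ε ∙ ε                   ≈⟨ identityˡ ε ⟩
      ε                       ∎

    A^[e%m]≈A^e : ∀ e → A ^ᴹ (e % m) ≈ A ^ᴹ e
    A^[e%m]≈A^e e = begin
      A ^ᴹ (e % m)                      ≈⟨ identityʳ _ ⟨
      A ^ᴹ (e % m) ∙ ε                  ≈⟨ ∙-congˡ (A^[k*m]≈ε (e / m)) ⟨
      A ^ᴹ (e % m) ∙ A ^ᴹ (e / m * m)   ≈⟨ ^ᴹ-+ A (e % m) (e / m * m) ⟨
      A ^ᴹ (e % m + e / m * m)          ≡⟨ ≡.cong (A ^ᴹ_) (ℕ.m≡m%n+[m/n]*n e m) ⟨
      A ^ᴹ e                            ∎

    B∙A^k≈A^[r*k]∙B : ∀ k → B ∙ A ^ᴹ k ≈ A ^ᴹ (r * k) ∙ B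
    B∙A^k≈A^[r*k]∙B zero = begin
      B ∙ ε               ≈⟨ identityʳ B ⟩
      B                   ≈⟨ identityˡ B ⟨
      ε ∙ B               ≡⟨ ≡.cong (λ e → A ^ᴹ e ∙ B) (ℕ.*-zeroʳ r) ⟨
      A ^ᴹ (r * 0) ∙ B    ∎
    B∙A^k≈A^[r*k]∙B (suc k) = begin
      B ∙ (A ∙ A ^ᴹ k)                  ≈⟨ assoc B A (A ^ᴹ k) ⟨
      (B ∙ A) ∙ A ^ᴹ k                  ≈⟨ ∙-congʳ B∙A≈A^r∙B ⟩
      (A ^ᴹ r ∙ B) ∙ A ^ᴹ k             ≈⟨ assoc (A ^ᴹ r) B (A ^ᴹ k) ⟩
      A ^ᴹ r ∙ (B ∙ A ^ᴹ k)             ≈⟨ ∙-congˡ (B∙A^k≈A^[r*k]∙B k) ⟩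
      A ^ᴹ r ∙ (A ^ᴹ (r * k) ∙ B)       ≈⟨ assoc (A ^ᴹ r) (A ^ᴹ (r * k)) B ⟨
      (A ^ᴹ r ∙ A ^ᴹ (r * k)) ∙ B       ≈⟨ ∙-congʳ (^ᴹ-+ A r (r * k)) ⟨
      A ^ᴹ (r + r * k) ∙ B              ≡⟨ ≡.cong (λ e → A ^ᴹ e ∙ B) (ℕ.*-suc r k) ⟨
      A ^ᴹ (r * suc k) ∙ B              ∎

    B^j∙A^k≈A^[r^j*k]∙B^j : ∀ j k → B ^ᴹ j ∙ A ^ᴹ k ≈ A ^ᴹ (r ^ j * k) ∙ B ^ᴹ j
    B^j∙A^k≈A^[r^j*k]∙B^j zero k = begin
      ε ∙ A ^ᴹ k          ≈⟨ identityˡ _ ⟩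
      A ^ᴹ k              ≈⟨ identityʳ _ ⟨
      A ^ᴹ k ∙ ε          ≡⟨ ≡.cong (λ e → A ^ᴹ e ∙ ε) (ℕ.*-identityˡ k) ⟨
      A ^ᴹ (1 * k) ∙ ε    ∎
    B^j∙A^k≈A^[r^j*k]∙B^j (suc j) k = begin
      (B ∙ B ^ᴹ j) ∙ A ^ᴹ k                    ≈⟨ assoc B (B ^ᴹ j) (A ^ᴹ k) ⟩
      B ∙ (B ^ᴹ j ∙ A ^ᴹ k)                    ≈⟨ ∙-congˡ (B^j∙A^k≈A^[r^j*k]∙B^j j k) ⟩
      B ∙ (A ^ᴹ (r ^ j * k) ∙ B ^ᴹ j)          ≈⟨ assoc B _ (B ^ᴹ j) ⟨
      (B ∙ A ^ᴹ (r ^ j * k)) ∙ B ^ᴹ j          ≈⟨ ∙-congʳ (B∙A^k≈A^[r*k]∙B (r ^ j * k)) ⟩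
      (A ^ᴹ (r * (r ^ j * k)) ∙ B) ∙ B ^ᴹ j    ≈⟨ assoc _ B (B ^ᴹ j) ⟩
      A ^ᴹ (r * (r ^ j * k)) ∙ (B ∙ B ^ᴹ j)    ≡⟨ ≡.cong (λ e → A ^ᴹ e ∙ (B ∙ B ^ᴹ j))
                                                          (ℕ.*-assoc r (r ^ j) k) ⟨
      A ^ᴹ (r * r ^ j * k) ∙ (B ∙ B ^ᴹ j)      ∎

    B^s≈A^carry∙B^[s%n] : ∀ s → s < n + n → B ^ᴹ s ≈ A ^ᴹ (if n ≤ᵇ s then t else 0) ∙ B ^ᴹ (s % n)
    B^s≈A^carry∙B^[s%n] s s<2n with n ≤ᵇ s in carry
    ... | false = begin
      B ^ᴹ s             ≡⟨ ≡.cong (B ^ᴹ_) (ℕ.m<n⇒m%n≡m s<n) ⟨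
      B ^ᴹ (s % n)       ≈⟨ identityˡ _ ⟨
      ε ∙ B ^ᴹ (s % n)   ∎
      where
      s<n : s < n
      s<n = ℕ.≰⇒> (λ n≤s → ≡.subst T carry (ℕ.≤⇒≤ᵇ n≤s))
    ... | true = begin
      B ^ᴹ s                        ≡⟨ ≡.cong (B ^ᴹ_) (ℕ.m+[n∸m]≡n n≤s) ⟨
      B ^ᴹ (n + (s ∸ n))            ≈⟨ ^ᴹ-+ B n (s ∸ n) ⟩
      B ^ᴹ n ∙ B ^ᴹ (s ∸ n)         ≈⟨ ∙-cong B^n≈A^t (reflexive (≡.cong (B ^ᴹ_) s∸n≡s%n)) ⟩
      A ^ᴹ t ∙ B ^ᴹ (s % n)         ∎
      where
      n≤s : n ℕ.≤ s
      n≤s = ℕ.≤ᵇ⇒≤ n s (≡.subst T (≡.sym carry) _)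
      s∸n≡s%n : s ∸ n ≡ s % n
      s∸n≡s%n = ≡.trans (≡.sym (ℕ.m<n⇒m%n≡m (ℕ.m<n+o⇒m∸n<o s n s<2n))) (ℕ.m≤n⇒[n∸m]%m≡n%m n≤s)

    open MGroup (Meta m n r t) using () renaming (_∙_ to _·_; ε to e)

    substitute-∙ : ∀ x y → substitute A B (x · y) ≈ substitute A B x ∙ substitute A B y
    substitute-∙ (i , j) (k , l) = begin
      A ^ᴹ toℕ (exponent mod m) ∙ B ^ᴹ toℕ ((J + L) mod n)
        ≡⟨ ≡.cong₂ (λ a b → A ^ᴹ a ∙ B ^ᴹ b) (toℕ-mod exponent m) (toℕ-mod (J + L) n) ⟩
      A ^ᴹ (exponent % m) ∙ B ^ᴹ ((J + L) % n)
        ≈⟨ ∙-congʳ (A^[e%m]≈A^e exponent) ⟩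
      A ^ᴹ (I + r ^ J * K + carry) ∙ B ^ᴹ ((J + L) % n)
        ≈⟨ ∙-congʳ (^ᴹ-+ A (I + r ^ J * K) carry) ⟩
      (A ^ᴹ (I + r ^ J * K) ∙ A ^ᴹ carry) ∙ B ^ᴹ ((J + L) % n)
        ≈⟨ assoc _ _ _ ⟩
      A ^ᴹ (I + r ^ J * K) ∙ (A ^ᴹ carry ∙ B ^ᴹ ((J + L) % n))
        ≈⟨ ∙-congˡ (B^s≈A^carry∙B^[s%n] (J + L) (ℕ.+-mono-< (Fin.toℕ<n j) (Fin.toℕ<n l))) ⟨
      A ^ᴹ (I + r ^ J * K) ∙ B ^ᴹ (J + L)
        ≈⟨ ∙-cong (^ᴹ-+ A I (r ^ J * K)) (^ᴹ-+ B J L) ⟩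
      (A ^ᴹ I ∙ A ^ᴹ (r ^ J * K)) ∙ (B ^ᴹ J ∙ B ^ᴹ L)
        ≈⟨ assoc _ _ _ ⟩
      A ^ᴹ I ∙ (A ^ᴹ (r ^ J * K) ∙ (B ^ᴹ J ∙ B ^ᴹ L))
        ≈⟨ ∙-congˡ (assoc _ _ _) ⟨
      A ^ᴹ I ∙ ((A ^ᴹ (r ^ J * K) ∙ B ^ᴹ J) ∙ B ^ᴹ L)
        ≈⟨ ∙-congˡ (∙-congʳ (B^j∙A^k≈A^[r^j*k]∙B^j J K)) ⟨
      A ^ᴹ I ∙ ((B ^ᴹ J ∙ A ^ᴹ K) ∙ B ^ᴹ L)
        ≈⟨ ∙-congˡ (assoc _ _ _) ⟩
      A ^ᴹ I ∙ (B ^ᴹ J ∙ (A ^ᴹ K ∙ B ^ᴹ L))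
        ≈⟨ assoc _ _ _ ⟨
      (A ^ᴹ I ∙ B ^ᴹ J) ∙ (A ^ᴹ K ∙ B ^ᴹ L) ∎
      where
      I J K L carry exponent : ℕ
      I = toℕ i
      J = toℕ j
      K = toℕ k
      L = toℕ l
      carry = if n ≤ᵇ J + L then t else 0
      exponent = I + r ^ J * K + carry

    substitute-ε : substitute A B e ≈ ε
    substitute-ε = begin
      A ^ᴹ toℕ (0 mod m) ∙ B ^ᴹ toℕ (0 mod n)
        ≡⟨ ≡.cong₂ (λ a b → A ^ᴹ a ∙ B ^ᴹ b) (toℕ-mod 0 m) (toℕ-mod 0 n) ⟩
      A ^ᴹ (0 % m) ∙ B ^ᴹ (0 % n)
        ≈⟨ ∙-cong (A^[e%m]≈A^e 0) (reflexive (≡.cong (B ^ᴹ_) (ℕ.m<n⇒m%n≡m (ℕ.>-nonZero⁻¹ n)))) ⟩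
      ε ∙ ε
        ≈⟨ identityˡ ε ⟩
      ε ∎

≅-trans : ∀ {H K L} → H ≅ K → K ≅ L → H ≅ L
≅-trans (f , f⁻¹ , f⁻¹∘f , f∘f⁻¹ , f-∙) (g , g⁻¹ , g⁻¹∘g , g∘g⁻¹ , g-∙) =
  (λ x → g (f x)) , (λ z → f⁻¹ (g⁻¹ z)) ,
  (λ x → ≡.trans (≡.cong f⁻¹ (g⁻¹∘g (f x))) (f⁻¹∘f x)) ,
  (λ z → ≡.trans (≡.cong g (f∘f⁻¹ (g⁻¹ z))) (g∘g⁻¹ z)) ,
  (λ x y → ≡.trans (≡.cong g (f-∙ x y)) (g-∙ (f x) (f y)))

module _ {m : ℕ} .{{_ : NonZero m}} where
  open import Data.Nat using (_+_; _*_; _^_)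
  open ≡ using (refl; cong₂)
  open ≡-Reasoning

  %-cong-+ : ∀ {a a′ b b′} → a % m ≡ a′ % m → b % m ≡ b′ % m → (a + b) % m ≡ (a′ + b′) % m
  %-cong-+ {a} {a′} {b} {b′} a≡a′ b≡b′ = begin
    (a + b) % m                 ≡⟨ ℕ.%-distribˡ-+ a b m ⟩
    (a % m + b % m) % m         ≡⟨ cong₂ (λ x y → (x + y) % m) a≡a′ b≡b′ ⟩
    (a′ % m + b′ % m) % m       ≡⟨ ℕ.%-distribˡ-+ a′ b′ m ⟨
    (a′ + b′) % m               ∎

  %-cong-* : ∀ {a a′ b b′} → a % m ≡ a′ % m → b % m ≡ b′ % m → (a * b) % m ≡ (a′ * b′) % m
  %-cong-* {a} {a′} {b} {b′} a≡a′ b≡b′ = begin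
    (a * b) % m                 ≡⟨ ℕ.%-distribˡ-* a b m ⟩
    (a % m * (b % m)) % m       ≡⟨ cong₂ (λ x y → (x * y) % m) a≡a′ b≡b′ ⟩
    (a′ % m * (b′ % m)) % m     ≡⟨ ℕ.%-distribˡ-* a′ b′ m ⟨
    (a′ * b′) % m               ∎

  %-cong-^ : ∀ {r r′} → r % m ≡ r′ % m → ∀ j → (r ^ j) % m ≡ (r′ ^ j) % m
  %-cong-^ r≡r′ zero    = refl
  %-cong-^ r≡r′ (suc j) = %-cong-* r≡r′ (%-cong-^ r≡r′ j)

module _ {m n r r′ t : ℕ} .{{_ : NonZero m}} .{{_ : NonZero n}} (r≡r′ : r % m ≡ r′ % m) where
  open import Data.Nat using (_+_; _*_; _^_; _≤ᵇ_)
  open MGroup (Meta m n r t) using () renaming (_∙_ to _∙ᵣ_)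
  open MGroup (Meta m n r′ t) using () renaming (_∙_ to _∙ᵣ′_)

  Meta-∙-residue : ∀ x y → x ∙ᵣ y ≡ x ∙ᵣ′ y
  Meta-∙-residue (i , j) (k , l) = ≡.cong (_, _) (Fin.toℕ-injective (begin
    toℕ ((toℕ i + r ^ toℕ j * toℕ k + carry) mod m)    ≡⟨ toℕ-mod _ m ⟩
    (toℕ i + r ^ toℕ j * toℕ k + carry) % m           ≡⟨ r≡r′-in-exponent ⟩
    (toℕ i + r′ ^ toℕ j * toℕ k + carry) % m          ≡⟨ toℕ-mod _ m ⟨
    toℕ ((toℕ i + r′ ^ toℕ j * toℕ k + carry) mod m)   ∎))
    where
    open ≡-Reasoning
    carry : ℕ
    carry = if n ≤ᵇ toℕ j + toℕ l then t else 0
    r≡r′-in-exponent : (toℕ i + r ^ toℕ j * toℕ k + carry) % m ≡ (toℕ i + r′ ^ toℕ j * toℕ k + carry) % m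
    r≡r′-in-exponent =
      %-cong-+ {b = carry} (%-cong-+ {a = toℕ i} ≡.refl (%-cong-* {b = toℕ k} (%-cong-^ r≡r′ (toℕ j)) ≡.refl)) ≡.refl

  Meta-≅-residue : Meta m n r t ≅ Meta m n r′ t
  Meta-≅-residue = (λ x → x) , (λ x → x) , (λ _ → ≡.refl) , (λ _ → ≡.refl) , Meta-∙-residue

  Meta-embeds-residue : EmbedsInDivisionRing (Meta m n r t) → EmbedsInDivisionRing (Meta m n r′ t)
  Meta-embeds-residue (D , f , f-∙ , f-ε , f-injective) =
    D , f , (λ x y → ≡.subst (λ z → f z ≈ f x · f y) (Meta-∙-residue x y) (f-∙ x y)) , f-ε , f-injective
    where open DivisionRing D using (_≈_; _·_)

-- MGroup asks for no group axioms; the injectivity argument below needs only this finite,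
-- decidable property of the multiplication.
RightInversesSeparate : MGroup → Set
RightInversesSeparate H = ∀ x y → ∃ λ w → y ∙ w ≡ ε × (x ∙ w ≡ ε → x ≡ y)
  where open MGroup H

module _ {H : MGroup} {c ℓ} (M : Monoid c ℓ) where
  open MGroup H renaming (Carrier to Element; _∙_ to _·_; ε to e)
  open Monoid M
  open import Relation.Binary.Reasoning.Setoid setoid

  trivialKernel⇒injective : RightInversesSeparate H → (φ : Element → Carrier) →
    (∀ x y → φ (x · y) ≈ φ x ∙ φ y) → φ e ≈ ε → (∀ g → φ g ≈ ε → g ≡ e) →
    ∀ x y → φ x ≈ φ y → x ≡ y
  trivialKernel⇒injective separate φ φ-∙ φ-e kernel x y φx≈φy with separate x y
  ... | w , y·w≡e , x·w≡e⇒x≡y = x·w≡e⇒x≡y (kernel (x · w) (begin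
    φ (x · w)     ≈⟨ φ-∙ x w ⟩
    φ x ∙ φ w     ≈⟨ ∙-congʳ φx≈φy ⟩
    φ y ∙ φ w     ≈⟨ φ-∙ y w ⟨
    φ (y · w)     ≡⟨ ≡.cong φ y·w≡e ⟩
    φ e           ≈⟨ φ-e ⟩
    ε             ∎))

module _ (D : DivisionRing) where
  open DivisionRing D
  open Ring ring using (*-monoid)
  open PresentationMap *-monoid

  Meta-embeds : ∀ {m n r t} .{{_ : NonZero m}} .{{_ : NonZero n}} {A B} →
    A ^ᴹ m ≈ 1# → B ^ᴹ n ≈ A ^ᴹ t → B · A ≈ A ^ᴹ r · B →
    RightInversesSeparate (Meta m n r t) →
    (∀ g → substitute A B g ≈ 1# → g ≡ MGroup.ε (Meta m n r t)) →
    EmbedsInDivisionRing (Meta m n r t)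
  Meta-embeds {m} {n} {r} {t} {A} {B} A^m≈1 B^n≈A^t B·A≈A^r·B separate kernel =
    D , substitute A B , substitute-homo , substitute-1 ,
    trivialKernel⇒injective *-monoid separate (substitute A B) substitute-homo substitute-1 kernel
    where
    open MGroup (Meta m n r t) using (_∙_; ε)
    substitute-homo : ∀ x y → substitute A B (x ∙ y) ≈ substitute A B x · substitute A B y
    substitute-homo = substitute-∙ {m} {n} {r} {t} A^m≈1 B^n≈A^t B·A≈A^r·B
    substitute-1 : substitute A B ε ≈ 1#
    substitute-1 = substitute-ε {m} {n} {r} {t} A^m≈1 B^n≈A^t B·A≈A^r·B

module _ {m n : ℕ} where

  all?² : {P : Pred (Fin m × Fin n) 0ℓ} → U.Decidable P → Dec (∀ x → P x)
  all?² P? = map′ uncurry curry (Fin.all? λ i → Fin.all? λ j → P? (i , j))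

  any?² : {P : Pred (Fin m × Fin n) 0ℓ} → U.Decidable P → Dec (∃ P)
  any?² P? = map′ (λ (i , j , p) → (i , j) , p) (λ ((i , j) , p) → i , j , p)
    (Fin.any? λ i → Fin.any? λ j → P? (i , j))

  _≟²_ : DecidableEquality (Fin m × Fin n)
  _≟²_ = Product.≡-dec Fin._≟_ Fin._≟_

rightInversesSeparate? : ∀ {m n r t} .{{_ : NonZero m}} .{{_ : NonZero n}} → Dec (RightInversesSeparate (Meta m n r t))
rightInversesSeparate? {m} {n} {r} {t} =
  all?² λ x → all?² λ y → any?² λ w → ((y ∙ w) ≟² ε) ×-dec (((x ∙ w) ≟² ε) →-dec (x ≟² y))
  where open MGroup (Meta m n r t)

-- Q₈, Dic₁₆ and Dic₂₄ embed into quaternions over ℚ(√2) and ℚ(√3)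

module QuaternionsOverℚ[√p] {p : ℕ} (p-prime : Prime p) where
  open QuadraticField (fromℕ p) public using (𝟘; 𝟙)
  open QuadraticField (fromℕ p) using (commutativeRing; ι-homomorphism; ⊗-inverseʳ; sum-of-squares≡𝟘; _≟_)
  open Quaternions commutativeRing ι-homomorphism public

  private instance
    p>0 : Positive (fromℕ p)
    p>0 = fromℕ-positive p {{prime⇒nonZero p-prime}}

  divisionRingℍ : DivisionRing
  divisionRingℍ = divisionRing (λ ()) (⊗-inverseʳ (prime⇒nonSquare p-prime)) sum-of-squares≡𝟘

  open Ring ring using (*-monoid)
  open PresentationMap *-monoid using (_^ᴹ_; substitute)

  Meta-embedsℍ : ∀ {m n r t} .{{_ : NonZero m}} .{{_ : NonZero n}} (A B : ℍ) →
    A ^ᴹ m ≈ℍ 1ℍ → B ^ᴹ n ≈ℍ A ^ᴹ t → B ⊗ A ≈ℍ A ^ᴹ r ⊗ B →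
    True (rightInversesSeparate? {m} {n} {r} {t}) →
    True (all?² λ g → ≈ℍ-dec _≟_ (substitute A B g) 1ℍ →-dec (g ≟² MGroup.ε (Meta m n r t))) →
    EmbedsInDivisionRing (Meta m n r t)
  Meta-embedsℍ A B A^m≈1 B^n≈A^t B·A≈A^r·B separate kernel =
    Meta-embeds divisionRingℍ A^m≈1 B^n≈A^t B·A≈A^r·B (toWitness separate) (toWitness kernel)

module ℍ₂ = QuaternionsOverℚ[√p] (from-yes (prime? 2))
module ℍ₃ = QuaternionsOverℚ[√p] (from-yes (prime? 3))

Q8-embeds : EmbedsInDivisionRing Q8
Q8-embeds = Meta-embedsℍ (𝟘 + 𝟙 𝐢+ 𝟘 𝐣+ 𝟘 𝐤) (𝟘 + 𝟘 𝐢+ 𝟙 𝐣+ 𝟘 𝐤)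
  ≈ℍ-refl ≈ℍ-refl ≈ℍ-refl _ _
  where open ℍ₂

-- a ↦ (1 + i)/√2 and b ↦ j
Dic16-embeds : EmbedsInDivisionRing Dic16
Dic16-embeds = Meta-embedsℍ ((0ℚ + ½ √D) + (0ℚ + ½ √D) 𝐢+ 𝟘 𝐣+ 𝟘 𝐤) (𝟘 + 𝟘 𝐢+ 𝟙 𝐣+ 𝟘 𝐤)
  ≈ℍ-refl ≈ℍ-refl ≈ℍ-refl _ _
  where open ℍ₂

-- a ↦ (√3 + i)/2 and b ↦ j
Dic24-embeds : EmbedsInDivisionRing Dic24
Dic24-embeds = Meta-embedsℍ ((0ℚ + ½ √D) + (½ + 0ℚ √D) 𝐢+ 𝟘 𝐣+ 𝟘 𝐤) (𝟘 + 𝟘 𝐢+ 𝟙 𝐣+ 𝟘 𝐤)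
  ≈ℍ-refl ≈ℍ-refl ≈ℍ-refl _ _
  where open ℍ₃

-- C₃ × Q₈ = G_{12,7} does not embed into a division ring

module DivisionRingProperties (D : DivisionRing) where
  open DivisionRing D using (ring; inverse)
  open Ring ring
  open RingProperties ring
  open CommutativeSemigroupProperties +-commutativeSemigroup using (interchange)
  open import Relation.Binary.Reasoning.Setoid setoid

  x≉0⇒x*y≈0⇒y≈0 : ∀ {x y} → ¬ x ≈ 0# → x * y ≈ 0# → y ≈ 0#
  x≉0⇒x*y≈0⇒y≈0 {x} {y} x≉0 x*y≈0 with inverse x x≉0
  ... | x⁻¹ , _ , x⁻¹*x≈1 = begin
    y               ≈⟨ *-identityˡ y ⟨
    1# * y          ≈⟨ *-congʳ x⁻¹*x≈1 ⟨
    (x⁻¹ * x) * y   ≈⟨ *-assoc x⁻¹ x y ⟩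
    x⁻¹ * (x * y)   ≈⟨ *-congˡ x*y≈0 ⟩
    x⁻¹ * 0#        ≈⟨ zeroʳ x⁻¹ ⟩
    0#              ∎

  x≉1⇒[x-1]*y≈0⇒y≈0 : ∀ {x y} → ¬ x ≈ 1# → (x - 1#) * y ≈ 0# → y ≈ 0#
  x≉1⇒[x-1]*y≈0⇒y≈0 x≉1 = x≉0⇒x*y≈0⇒y≈0 (λ x-1≈0 → x≉1 (x∙y⁻¹≈ε⇒x≈y _ _ x-1≈0))

  x*x≈1⇒x≈-1 : ∀ {x} → x * x ≈ 1# → ¬ x ≈ 1# → x ≈ - 1#
  x*x≈1⇒x≈-1 {x} x*x≈1 x≉1 = +-inverseˡ-unique x 1# (x≉1⇒[x-1]*y≈0⇒y≈0 x≉1 (begin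
    (x - 1#) * (x + 1#)                 ≈⟨ distribˡ (x - 1#) x 1# ⟩
    (x - 1#) * x + (x - 1#) * 1#        ≈⟨ +-cong ([y-z]x≈yx-zx x x 1#) (*-identityʳ (x - 1#)) ⟩
    (x * x - 1# * x) + (x - 1#)         ≈⟨ +-congʳ (+-cong x*x≈1 (-‿cong (*-identityˡ x))) ⟩
    (1# - x) + (x - 1#)                 ≈⟨ +-congʳ (⁻¹-anti-homo‿- x 1#) ⟨
    - (x - 1#) + (x - 1#)               ≈⟨ -‿inverseˡ (x - 1#) ⟩
    0#                                  ∎))

  x*[x*x]≈1⇒x*x+x+1≈0 : ∀ {x} → x * (x * x) ≈ 1# → ¬ x ≈ 1# → x * x + x + 1# ≈ 0#
  x*[x*x]≈1⇒x*x+x+1≈0 {x} x³≈1 x≉1 = x≉1⇒[x-1]*y≈0⇒y≈0 x≉1 (begin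
    (x - 1#) * s        ≈⟨ [y-z]x≈yx-zx s x 1# ⟩
    x * s - 1# * s      ≈⟨ +-cong x*s≈s (-‿cong (*-identityˡ s)) ⟩
    s - s               ≈⟨ -‿inverseʳ s ⟩
    0#                  ∎)
    where
    s : Carrier
    s = x * x + x + 1#
    x*s≈s : x * s ≈ s
    x*s≈s = begin
      x * (x * x + x + 1#)              ≈⟨ distribˡ x (x * x + x) 1# ⟩
      x * (x * x + x) + x * 1#          ≈⟨ +-congʳ (distribˡ x (x * x) x) ⟩
      x * (x * x) + x * x + x * 1#      ≈⟨ +-cong (+-congʳ x³≈1) (*-identityʳ x) ⟩
      1# + x * x + x                    ≈⟨ +-assoc 1# (x * x) x ⟩
      1# + (x * x + x)                  ≈⟨ +-comm 1# (x * x + x) ⟩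
      x * x + x + 1#                    ∎

  -- Only ¬ ¬: equality in D need not be decidable, so x ≈ 1 ⊎ x ≈ - 1 cannot be split.
  x*x≈1⇒¬¬x*y≈y*x : ∀ {x} → x * x ≈ 1# → ∀ y → ¬ ¬ x * y ≈ y * x
  x*x≈1⇒¬¬x*y≈y*x {x} x*x≈1 y x*y≉y*x =
    x*y≉y*x (commutes (x*x≈1⇒x≈-1 x*x≈1 (λ x≈1 → x*y≉y*x (commutes x≈1 1-central))) -1-central)
    where
    commutes : ∀ {c} → x ≈ c → (∀ z → c * z ≈ z * c) → x * y ≈ y * x
    commutes {c} x≈c c-central = begin
      x * y   ≈⟨ *-congʳ x≈c ⟩
      c * y   ≈⟨ c-central y ⟩
      y * c   ≈⟨ *-congˡ x≈c ⟨
      y * x   ∎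
    1-central : ∀ z → 1# * z ≈ z * 1#
    1-central z = trans (*-identityˡ z) (sym (*-identityʳ z))
    -1-central : ∀ z → - 1# * z ≈ z * - 1#
    -1-central z = begin
      - 1# * z    ≈⟨ -1*x≈-x z ⟩
      - z         ≈⟨ -‿cong (*-identityʳ z) ⟨
      - (z * 1#)  ≈⟨ -‿distribʳ-* z 1# ⟩
      z * - 1#    ∎

  anticommuting-pair⇒¬¬v*w≈0 : ¬ 1# + 1# ≈ 0# → ∀ {u v w} →
    u * u + v * v ≈ 1# → u * v + v * u ≈ 0# → w * u ≈ u * w → w * v + v * w ≈ 0# → ¬ ¬ v * w ≈ 0#
  anticommuting-pair⇒¬¬v*w≈0 2≉0 {u} {v} {w} u²+v²≈1 uv+vu≈0 wu≈uw wv+vw≈0 vw≉0 =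
    x*x≈1⇒¬¬x*y≈y*x [u+v]²≈1 w λ [u+v]w≈w[u+v] →
      vw≉0 (x≉0⇒x*y≈0⇒y≈0 2≉0 (2vw≈0 (vw≈wv [u+v]w≈w[u+v])))
    where
    [u+v]²≈1 : (u + v) * (u + v) ≈ 1#
    [u+v]²≈1 = begin
      (u + v) * (u + v)                   ≈⟨ distribʳ (u + v) u v ⟩
      u * (u + v) + v * (u + v)           ≈⟨ +-cong (distribˡ u u v) (distribˡ v u v) ⟩
      (u * u + u * v) + (v * u + v * v)   ≈⟨ +-congˡ (+-comm (v * u) (v * v)) ⟩
      (u * u + u * v) + (v * v + v * u)   ≈⟨ interchange (u * u) (u * v) (v * v) (v * u) ⟩
      (u * u + v * v) + (u * v + v * u)   ≈⟨ +-cong u²+v²≈1 uv+vu≈0 ⟩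
      1# + 0#                             ≈⟨ +-identityʳ 1# ⟩
      1#                                  ∎
    vw≈wv : (u + v) * w ≈ w * (u + v) → v * w ≈ w * v
    vw≈wv [u+v]w≈w[u+v] = +-cancelˡ (u * w) (v * w) (w * v) (begin
      u * w + v * w     ≈⟨ distribʳ w u v ⟨
      (u + v) * w       ≈⟨ [u+v]w≈w[u+v] ⟩
      w * (u + v)       ≈⟨ distribˡ w u v ⟩
      w * u + w * v     ≈⟨ +-congʳ wu≈uw ⟩
      u * w + w * v     ∎)
    2vw≈0 : v * w ≈ w * v → (1# + 1#) * (v * w) ≈ 0#
    2vw≈0 vw≈wv = begin
      (1# + 1#) * (v * w)           ≈⟨ distribʳ (v * w) 1# 1# ⟩
      1# * (v * w) + 1# * (v * w)   ≈⟨ +-cong (*-identityˡ (v * w)) (*-identityˡ (v * w)) ⟩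
      v * w + v * w                 ≈⟨ +-congʳ vw≈wv ⟩
      w * v + v * w                 ≈⟨ wv+vw≈0 ⟩
      0#                            ∎

C₃×Q₈ : MGroup
C₃×Q₈ = Meta 12 2 7 2

a^[_] a^[_]b : (k : ℕ) {k<12 : True (k ℕ.<? 12)} → Fin 12 × Fin 2
a^[ k ] {k<12} = #_ k {m<n = k<12} , Fin.zero
a^[ k ]b {k<12} = #_ k {m<n = k<12} , Fin.suc Fin.zero

module EmbeddingOfC₃×Q₈ (D : DivisionRing) (f : Fin 12 × Fin 2 → DivisionRing.Carrier D) where
  open DivisionRing D using (ring; 0≉1)
  open Ring ring
  open RingProperties ring
  open DivisionRingProperties D
  open MGroup C₃×Q₈ using () renaming (_∙_ to _·_; ε to e)
  open import Relation.Binary.Reasoning.Setoid setoid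

  module _ (f-· : ∀ x y → f (x · y) ≈ f x * f y) (f-e : f e ≈ 1#)
           (f-injective : ∀ x y → f x ≈ f y → x ≡ y) where

    f-≡ : ∀ {x y z} → x · y ≡ z → f x * f y ≈ f z
    f-≡ ≡.refl = sym (f-· _ _)

    f≉0 : ∀ x y → x · y ≡ e → ¬ f x ≈ 0#
    f≉0 x y x·y≡e fx≈0 = 0≉1 (begin
      0#            ≈⟨ zeroˡ (f y) ⟨
      0# * f y      ≈⟨ *-congʳ fx≈0 ⟨
      f x * f y     ≈⟨ f-≡ x·y≡e ⟩
      f e           ≈⟨ f-e ⟩
      1#            ∎)

    f≉1 : ∀ {x} → x ≢ e → ¬ f x ≈ 1#
    f≉1 x≢e fx≈1 = x≢e (f-injective _ _ (trans fx≈1 (sym f-e)))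

    f[a⁶]≈-1 : f a^[ 6 ] ≈ - 1#
    f[a⁶]≈-1 = x*x≈1⇒x≈-1 (trans (f-≡ ≡.refl) f-e) (f≉1 λ ())

    f[a⁶x]≈-fx : ∀ x → f (a^[ 6 ] · x) ≈ - f x
    f[a⁶x]≈-fx x = begin
      f (a^[ 6 ] · x)      ≈⟨ f-· a^[ 6 ] x ⟩
      f a^[ 6 ] * f x      ≈⟨ *-congʳ f[a⁶]≈-1 ⟩
      - 1# * f x           ≈⟨ -1*x≈-x (f x) ⟩
      - f x                ∎

    1+1≉0 : ¬ 1# + 1# ≈ 0#
    1+1≉0 2≈0 = f≉1 {a^[ 6 ]} (λ ()) (trans f[a⁶]≈-1 (sym (+-inverseˡ-unique 1# 1# 2≈0)))

    ω²+ω≈-1 : f a^[ 8 ] + f a^[ 4 ] ≈ - 1#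
    ω²+ω≈-1 = +-inverseˡ-unique _ 1# (begin
      f a^[ 8 ] + f a^[ 4 ] + 1#              ≈⟨ +-congʳ (+-congʳ (f-≡ ≡.refl)) ⟨
      f a^[ 4 ] * f a^[ 4 ] + f a^[ 4 ] + 1#  ≈⟨ x*[x*x]≈1⇒x*x+x+1≈0 ω³≈1 (f≉1 λ ()) ⟩
      0#                                      ∎)
      where
      ω³≈1 : f a^[ 4 ] * (f a^[ 4 ] * f a^[ 4 ]) ≈ 1#
      ω³≈1 = trans (*-congˡ (f-≡ ≡.refl)) (trans (f-≡ ≡.refl) f-e)

    u v w : Carrier
    u = f a^[ 7 ]
    v = f a^[ 10 ]b
    w = f a^[ 3 ]

    u*u+v*v≈1 : u * u + v * v ≈ 1#
    u*u+v*v≈1 = begin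
      u * u + v * v                                   ≈⟨ +-cong (f-≡ ≡.refl) (f-≡ ≡.refl) ⟩
      f (a^[ 6 ] · a^[ 8 ]) + f (a^[ 6 ] · a^[ 4 ])   ≈⟨ +-cong (f[a⁶x]≈-fx a^[ 8 ]) (f[a⁶x]≈-fx a^[ 4 ]) ⟩
      - f a^[ 8 ] + - f a^[ 4 ]                       ≈⟨ -‿+-comm (f a^[ 8 ]) (f a^[ 4 ]) ⟩
      - (f a^[ 8 ] + f a^[ 4 ])                       ≈⟨ -‿cong ω²+ω≈-1 ⟩
      - - 1#                                          ≈⟨ -‿involutive 1# ⟩
      1#                                              ∎

    u*v+v*u≈0 : u * v + v * u ≈ 0#
    u*v+v*u≈0 = begin
      u * v + v * u                           ≈⟨ +-cong (f-≡ ≡.refl) (f-≡ ≡.refl) ⟩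
      f a^[ 5 ]b + f (a^[ 6 ] · a^[ 5 ]b)     ≈⟨ +-congˡ (f[a⁶x]≈-fx a^[ 5 ]b) ⟩
      f a^[ 5 ]b - f a^[ 5 ]b                 ≈⟨ -‿inverseʳ (f a^[ 5 ]b) ⟩
      0#                                      ∎

    w*u≈u*w : w * u ≈ u * w
    w*u≈u*w = trans (f-≡ ≡.refl) (sym (f-≡ ≡.refl))

    w*v+v*w≈0 : w * v + v * w ≈ 0#
    w*v+v*w≈0 = begin
      w * v + v * w                           ≈⟨ +-cong (f-≡ ≡.refl) (f-≡ ≡.refl) ⟩
      f a^[ 1 ]b + f (a^[ 6 ] · a^[ 1 ]b)     ≈⟨ +-congˡ (f[a⁶x]≈-fx a^[ 1 ]b) ⟩
      f a^[ 1 ]b - f a^[ 1 ]b                 ≈⟨ -‿inverseʳ (f a^[ 1 ]b) ⟩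
      0#                                      ∎

    v*w≉0 : ¬ v * w ≈ 0#
    v*w≉0 vw≈0 = f≉0 a^[ 7 ]b a^[ 9 ]b ≡.refl (trans (sym (f-≡ ≡.refl)) vw≈0)

    absurd : ⊥
    absurd = anticommuting-pair⇒¬¬v*w≈0 1+1≉0 u*u+v*v≈1 u*v+v*u≈0 w*u≈u*w w*v+v*w≈0 v*w≉0

C₃×Q₈-¬embeds : ¬ EmbedsInDivisionRing C₃×Q₈
C₃×Q₈-¬embeds (D , f , f-· , f-e , f-injective) = EmbeddingOfC₃×Q₈.absurd D f f-· f-e f-injective

-- x ∙ x ≢ x says that x is not the identity; the order condition is stated without ε,
-- which an MGroup is not required to make a neutral element.
HasCentralElementOfOrder3 : MGroup → Set
HasCentralElementOfOrder3 H = ∃ λ x → (∀ y → x ∙ y ≡ y ∙ x) × (∀ y → x ∙ (x ∙ (x ∙ y)) ≡ y) × x ∙ x ≢ x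
  where open MGroup H

≅-HasCentralElementOfOrder3 : ∀ {H K} → H ≅ K → HasCentralElementOfOrder3 H → HasCentralElementOfOrder3 K
≅-HasCentralElementOfOrder3 {H} {K} (f , g , g∘f , f∘g , f-∙) (x , central , cube , x·x≢x) =
  f x , central′ , cube′ , λ fx∙fx≡fx → x·x≢x (injective (≡.trans (f-∙ x x) fx∙fx≡fx))
  where
  open MGroup H using () renaming (_∙_ to _·_)
  open MGroup K using (_∙_)
  open ≡-Reasoning
  injective : ∀ {y z} → f y ≡ f z → y ≡ z
  injective {y} {z} fy≡fz = ≡.trans (≡.sym (g∘f y)) (≡.trans (≡.cong g fy≡fz) (g∘f z))
  f-∙-preimage : ∀ x y → f x ∙ y ≡ f (x · g y)
  f-∙-preimage x y = ≡.trans (≡.cong (f x ∙_) (≡.sym (f∘g y))) (≡.sym (f-∙ x (g y)))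
  central′ : ∀ y → f x ∙ y ≡ y ∙ f x
  central′ y = begin
    f x ∙ y         ≡⟨ f-∙-preimage x y ⟩
    f (x · g y)     ≡⟨ ≡.cong f (central (g y)) ⟩
    f (g y · x)     ≡⟨ f-∙ (g y) x ⟩
    f (g y) ∙ f x   ≡⟨ ≡.cong (_∙ f x) (f∘g y) ⟩
    y ∙ f x         ∎
  cube′ : ∀ y → f x ∙ (f x ∙ (f x ∙ y)) ≡ y
  cube′ y = begin
    f x ∙ (f x ∙ (f x ∙ y))       ≡⟨ ≡.cong (λ z → f x ∙ (f x ∙ z)) (f-∙-preimage x y) ⟩
    f x ∙ (f x ∙ f (x · g y))     ≡⟨ ≡.cong (f x ∙_) (f-∙ x (x · g y)) ⟨
    f x ∙ f (x · (x · g y))       ≡⟨ f-∙ x (x · (x · g y)) ⟨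
    f (x · (x · (x · g y)))       ≡⟨ ≡.cong f (cube (g y)) ⟩
    f (g y)                       ≡⟨ f∘g y ⟩
    y                             ∎

centralElementOfOrder3? : ∀ {m n r t} .{{_ : NonZero m}} .{{_ : NonZero n}} →
                          Dec (HasCentralElementOfOrder3 (Meta m n r t))
centralElementOfOrder3? {m} {n} {r} {t} =
  any?² λ x → (all?² λ y → (x ∙ y) ≟² (y ∙ x)) ×-dec
              (all?² λ y → (x ∙ (x ∙ (x ∙ y))) ≟² y) ×-dec
              ¬? ((x ∙ x) ≟² x)
  where open MGroup (Meta m n r t)

C₃×Q₈-central-order-3 : HasCentralElementOfOrder3 C₃×Q₈
C₃×Q₈-central-order-3 = from-yes (centralElementOfOrder3? {12} {2} {7} {2})

C₃×Q₈≇Q8 : ¬ C₃×Q₈ ≅ Q8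
C₃×Q₈≇Q8 iso = from-no (centralElementOfOrder3? {4} {2} {3} {2})
  (≅-HasCentralElementOfOrder3 {C₃×Q₈} {Q8} iso C₃×Q₈-central-order-3)

C₃×Q₈≇Dic16 : ¬ C₃×Q₈ ≅ Dic16
C₃×Q₈≇Dic16 iso = from-no (centralElementOfOrder3? {8} {2} {7} {4})
  (≅-HasCentralElementOfOrder3 {C₃×Q₈} {Dic16} iso C₃×Q₈-central-order-3)

C₃×Q₈≇Dic24 : ¬ C₃×Q₈ ≅ Dic24
C₃×Q₈≇Dic24 iso = from-no (centralElementOfOrder3? {12} {2} {11} {6})
  (≅-HasCentralElementOfOrder3 {C₃×Q₈} {Dic24} iso C₃×Q₈-central-order-3)

-- The arithmetic hypotheses leave four cases

-- Opened only here because the ring sections above use _+_ and _*_ for ring operations.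
open import Data.Nat using (_+_; _*_; _^_; _∸_; _≤_; _<_)

gcd[m+k*n,n]≡gcd[m,n] : ∀ m k n → gcd (m + k * n) n ≡ gcd m n
gcd[m+k*n,n]≡gcd[m,n] m k n = ℕ.∣-antisym
  (gcd-greatest (ℕ.∣m+n∣m⇒∣n (≡.subst (gcd (m + k * n) n ∣_) (ℕ.+-comm m (k * n)) (gcd[m,n]∣m (m + k * n) n))
                             (ℕ.∣-trans (gcd[m,n]∣n (m + k * n) n) (ℕ.n∣m*n k)))
                (gcd[m,n]∣n (m + k * n) n))
  (gcd-greatest (ℕ.∣m∣n⇒∣m+n (gcd[m,n]∣m m n) (ℕ.∣-trans (gcd[m,n]∣n m n) (ℕ.n∣m*n k)))
                (gcd[m,n]∣n m n))

module _ {m : ℕ} .{{_ : NonZero m}} where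

  gcd[r∸1,m]≡gcd[r%m∸1,m] : ∀ r → 0 < r % m → gcd (r ∸ 1) m ≡ gcd (r % m ∸ 1) m
  gcd[r∸1,m]≡gcd[r%m∸1,m] r 0<r%m = begin
    gcd (r ∸ 1) m                          ≡⟨ ≡.cong (λ x → gcd (x ∸ 1) m) (ℕ.m≡m%n+[m/n]*n r m) ⟩
    gcd (r % m + r / m * m ∸ 1) m          ≡⟨ ≡.cong (λ x → gcd x m) (ℕ.+-∸-comm (r / m * m) 0<r%m) ⟩
    gcd (r % m ∸ 1 + r / m * m) m          ≡⟨ gcd[m+k*n,n]≡gcd[m,n] (r % m ∸ 1) (r / m) m ⟩
    gcd (r % m ∸ 1) m                      ∎
    where open ≡-Reasoning

  t*gcd[ρ,m]≡m : ∀ r t {ρ} → r % m ≡ suc ρ → t * gcd (r ∸ 1) m ≡ m → t * gcd ρ m ≡ m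
  t*gcd[ρ,m]≡m r t r%m≡1+ρ t*gcd≡m = ≡.trans (≡.cong (t *_) (≡.sym (≡.trans
    (gcd[r∸1,m]≡gcd[r%m∸1,m] r (≡.subst (0 <_) (≡.sym r%m≡1+ρ) (s≤s z≤n)))
    (≡.cong (λ x → gcd (x ∸ 1) m) r%m≡1+ρ)))) t*gcd≡m

  coprime-% : ∀ {r} → Coprime m r → Coprime m (r % m)
  coprime-% m⊥r (d∣m , d∣r%m) = m⊥r (d∣m , ℕ.∣n∣m%n⇒∣m d∣m d∣r%m)

  ∣[r+1]*k⇒∣[r%m+1]*k : ∀ r k → m ∣ (r + 1) * k → m ∣ (r % m + 1) * k
  ∣[r+1]*k⇒∣[r%m+1]*k r k m∣[r+1]*k = ℕ.m%n≡0⇒n∣m _ m (≡.trans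
    (%-cong-* {b = k} (%-cong-+ {b = 1} (ℕ.m%n%n≡m%n r m) ≡.refl) ≡.refl)
    (ℕ.n∣m⇒m%n≡0 _ m m∣[r+1]*k))

ResidueClass : ℕ → ℕ → Set
ResidueClass m ρ = (m ≡ 4 × ρ ≡ 3) ⊎ (m ≡ 8 × ρ ≡ 7) ⊎ (m ≡ 12 × ρ ≡ 11) ⊎ (m ≡ 12 × ρ ≡ 7)

residueClass : ∀ {m m′ ρ} → m ≤ 12 → ρ < m → 4 * m′ ∣ m → ¬ 2 ∣ m′ → m ∣ (ρ + 1) * m′ → Coprime m ρ →
               ResidueClass m ρ
residueClass {m} {m′} m≤12 ρ<m 4m′∣m = table (s≤s m≤12) (s≤s m′≤12) ρ<m 4m′∣m
  where
  open import Data.Nat using (_≟_)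
  instance
    m-nonZero : NonZero m
    m-nonZero = ℕ.>-nonZero (ℕ.≤-trans (s≤s z≤n) ρ<m)
  m′≤12 : m′ ≤ 12
  m′≤12 = ℕ.≤-trans (ℕ.m≤n*m m′ 4) (ℕ.≤-trans (ℕ.∣⇒≤ 4m′∣m) m≤12)
  Conclusion : ℕ → ℕ → ℕ → Set
  Conclusion m m′ ρ = 4 * m′ ∣ m → ¬ 2 ∣ m′ → m ∣ (ρ + 1) * m′ → Coprime m ρ → ResidueClass m ρ
  table : ∀ {m} → m < 13 → ∀ {m′} → m′ < 13 → ∀ {ρ} → ρ < m → Conclusion m m′ ρ
  table = from-yes (ℕ.allUpTo? (λ m → ℕ.allUpTo? (λ m′ → ℕ.allUpTo? (λ ρ →
    (4 * m′ ∣? m) →-dec (¬? (2 ∣? m′) →-dec (m ∣? (ρ + 1) * m′ →-dec (coprime? m ρ →-dec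
      ((m ≟ 4) ×-dec (ρ ≟ 3) ⊎-dec (m ≟ 8) ×-dec (ρ ≟ 7) ⊎-dec
       (m ≟ 12) ×-dec (ρ ≟ 11) ⊎-dec (m ≟ 12) ×-dec (ρ ≟ 7)))))) m) 13) 13)

data Classification : ℕ → ℕ → ℕ → Set where
  Q8-case     : Classification 4 3 2
  Dic16-case  : Classification 8 7 4
  Dic24-case  : Classification 12 11 6
  C₃×Q₈-case : Classification 12 7 2

classify : ∀ {m r t α m′} .{{_ : NonZero m}} → Coprime m r → t * gcd (r ∸ 1) m ≡ m →
  m ≡ 2 ^ α * m′ → m ≤ 12 → 2 ^ α ∣ r + 1 → 2 ≤ α → ¬ 2 ∣ m′ →
  ∃ λ ρ → r % m ≡ ρ × Classification m ρ t
classify {m} {r} {t} {suc (suc k)} {m′} m⊥r t*gcd≡m m≡2^α*m′ m≤12 2^α∣r+1 (s≤s (s≤s z≤n)) m′-odd =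
  fromResidueClass ≡.refl t*gcd≡m
    (residueClass m≤12 (ℕ.m%n<n r m) 4m′∣m m′-odd m∣[r%m+1]*m′ (coprime-% m⊥r))
  where
  4m′∣m : 4 * m′ ∣ m
  4m′∣m = divides (2 ^ k) (≡.trans m≡2^α*m′ (2*[2*x]*y≡x*[4*y] (2 ^ k) m′))
    where
    2*[2*x]*y≡x*[4*y] : ∀ x y → 2 * (2 * x) * y ≡ x * (4 * y)
    2*[2*x]*y≡x*[4*y] = ℕ-Solver.solve-∀
  m∣[r%m+1]*m′ : m ∣ (r % m + 1) * m′
  m∣[r%m+1]*m′ = ∣[r+1]*k⇒∣[r%m+1]*k r m′
    (≡.subst (_∣ (r + 1) * m′) (≡.sym m≡2^α*m′) (ℕ.*-monoˡ-∣ m′ 2^α∣r+1))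
  fromResidueClass : ∀ {m ρ} .{{_ : NonZero m}} → r % m ≡ ρ → t * gcd (r ∸ 1) m ≡ m → ResidueClass m ρ →
                     ∃ λ ρ → r % m ≡ ρ × Classification m ρ t
  fromResidueClass r%m≡ρ t*gcd≡m (inj₁ (≡.refl , ≡.refl)) =
    3 , r%m≡ρ , ≡.subst (Classification 4 3) (≡.sym (ℕ.*-cancelʳ-≡ t 2 2 (t*gcd[ρ,m]≡m r t r%m≡ρ t*gcd≡m))) Q8-case
  fromResidueClass r%m≡ρ t*gcd≡m (inj₂ (inj₁ (≡.refl , ≡.refl))) =
    7 , r%m≡ρ , ≡.subst (Classification 8 7) (≡.sym (ℕ.*-cancelʳ-≡ t 4 2 (t*gcd[ρ,m]≡m r t r%m≡ρ t*gcd≡m))) Dic16-case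
  fromResidueClass r%m≡ρ t*gcd≡m (inj₂ (inj₂ (inj₁ (≡.refl , ≡.refl)))) =
    11 , r%m≡ρ , ≡.subst (Classification 12 11) (≡.sym (ℕ.*-cancelʳ-≡ t 6 2 (t*gcd[ρ,m]≡m r t r%m≡ρ t*gcd≡m))) Dic24-case
  fromResidueClass r%m≡ρ t*gcd≡m (inj₂ (inj₂ (inj₂ (≡.refl , ≡.refl)))) =
    7 , r%m≡ρ , ≡.subst (Classification 12 7) (≡.sym (ℕ.*-cancelʳ-≡ t 2 6 (t*gcd[ρ,m]≡m r t r%m≡ρ t*gcd≡m))) C₃×Q₈-case

embeds⇔Q8⊎Dic16⊎Dic24 : ∀ {m r t ρ} .{{_ : NonZero m}} → r % m ≡ ρ → Classification m ρ t →
  EmbedsInDivisionRing (G m r 2 t) ⇔ (G m r 2 t ≅ Q8 ⊎ (G m r 2 t ≅ Dic16 ⊎ G m r 2 t ≅ Dic24))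
embeds⇔Q8⊎Dic16⊎Dic24 r≡ Q8-case =
  mk⇔ (λ _ → inj₁ (Meta-≅-residue r≡)) (λ _ → Meta-embeds-residue (≡.sym r≡) Q8-embeds)
embeds⇔Q8⊎Dic16⊎Dic24 r≡ Dic16-case =
  mk⇔ (λ _ → inj₂ (inj₁ (Meta-≅-residue r≡))) (λ _ → Meta-embeds-residue (≡.sym r≡) Dic16-embeds)
embeds⇔Q8⊎Dic16⊎Dic24 r≡ Dic24-case =
  mk⇔ (λ _ → inj₂ (inj₂ (Meta-≅-residue r≡))) (λ _ → Meta-embeds-residue (≡.sym r≡) Dic24-embeds)
embeds⇔Q8⊎Dic16⊎Dic24 {m} {r} {t} r≡ C₃×Q₈-case =
  mk⇔ (λ embeds → ⊥-elim (C₃×Q₈-¬embeds (Meta-embeds-residue r≡ embeds)))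
      [ (λ iso → ⊥-elim (C₃×Q₈≇Q8 (≅-trans {C₃×Q₈} {G m r 2 t} {Q8} C₃×Q₈≅G iso)))
      , [ (λ iso → ⊥-elim (C₃×Q₈≇Dic16 (≅-trans {C₃×Q₈} {G m r 2 t} {Dic16} C₃×Q₈≅G iso)))
        , (λ iso → ⊥-elim (C₃×Q₈≇Dic24 (≅-trans {C₃×Q₈} {G m r 2 t} {Dic24} C₃×Q₈≅G iso))) ]′ ]′
  where
  C₃×Q₈≅G : C₃×Q₈ ≅ G m r 2 t
  C₃×Q₈≅G = Meta-≅-residue (≡.sym r≡)

lemma5p8 : (m r : ℕ) → .{{_ : NonZero m}} → 0 < r → Coprime m r →
    (s t α m′ s′ : ℕ) →
    s ≡ gcd (r ∸ 1) m → t * s ≡ m →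
    IsOrderMod m r 2 →
    m ≡ 2 ^ α * m′ → m ≤ 12 → s ≡ 2 * s′ → gcd s t ≡ 2 →
    2 ^ α ∣ r + 1 →
    2 ≤ α → ¬ (2 ∣ m′) → ¬ (2 ∣ s′) →
    EmbedsInDivisionRing (G m r 2 t) ⇔ (G m r 2 t ≅ Q8 ⊎ (G m r 2 t ≅ Dic16 ⊎ G m r 2 t ≅ Dic24))
lemma5p8 m r _ m⊥r s t α m′ _ s≡gcd t*s≡m _ m≡2^α*m′ m≤12 _ _ 2^α∣r+1 2≤α m′-odd _
  with classify m⊥r (≡.subst (λ s → t * s ≡ m) s≡gcd t*s≡m) m≡2^α*m′ m≤12 2^α∣r+1 2≤α m′-odd
... | ρ , r%m≡ρ , classification = embeds⇔Q8⊎Dic16⊎Dic24 r%m≡ρ classification
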